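{- For every $n\in\mathbb{N}^*$: 1) $NCPP_n(2n)=\big\{\{(h,2n+1-h)\}_{h=1}^n\big\}$ and $PP_n(2n)=\big\{\{(h,n+\sigma(h))\}_{h=1}^n:\sigma\in\mathfrak{S}_n\big\}$; consequently $|PP_n(2n)|=n!$ and $|NCPP_n(2n)|=1$. 2) $|PP_1(2n)|=|PP(2n-2)|=(2n-3)!!$ and $|NCPP_1(2n)|=|NCPP(2n-2)|=\frac{1}{n}\binom{2n-2}{n-1}$. 3) If $n>2$ and $k\in\{2,\ldots,n-1\}$, then $NCPP_k(2n)$ is in bijection with $\bigcup_{h=k-1}^{n-1}NCPP_h(2n-2)$; in particular $NCPP_2(2n)$ is in bijection with $NCPP(2n-2)$, and $$|NCPP_k(2n)|=\sum_{h=k-1}^{n-1}|NCPP_h(2n-2)|,$$ $$|NCPP_2(2n)|=|NCPP_1(2n)|=|NCPP(2n-2)|=C_{n-1}=\tfrac{1}{n}\binom{2n-2}{n-1},\qquad |NCPP_{n-1}(2n)|=n-1.$$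
   Context: For $n\in\mathbb{N}^*$, a pair partition of $\{1,\ldots,2n\}$ is a family $\{(l_h,r_h)\}_{h=1}^n$ with $\{l_h\}\cup\{r_h\}=\{1,\ldots,2n\}$, $l_h<r_h$, and $l_1<\cdots<l_n$; $PP(2n)$ is the set of them. It is non-crossing if for all $1\le h<k\le n$: $l_k<r_h$ iff $r_k<r_h$; $NCPP(2n)$ is the set of non-crossing ones. For $k\in\{1,\ldots,n\}$, $PP_k(2n):=\{\theta\in PP(2n):2n-l_n=k\}$ and $NCPP_k(2n):=\{\theta\in NCPP(2n): 2n-l_n=k\}$. $\mathfrak{S}_n$ is the symmetric group on $\{1,\ldots,n\}$; $(2n-1)!!:=(2n-1)(2n-3)\cdots 3\cdot 1$, with $(-1)!!=1$ and $PP(0)=NCPP(0)$ consisting of the single empty partition; $C_n=\frac{1}{n+1}\binom{2n}{n}$ is the $n$-th Catalan number. -}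

module Defs where

open import Data.Nat using (ℕ; zero; suc; _+_; _*_; _∸_; _≤_; _<_; NonZero)
open import Data.Nat.DivMod using (_/_)
open import Data.Nat.Combinatorics using (_C_)
open import Data.Fin as Fin using (Fin; toℕ)
open import Data.Fin.Permutation using (Permutation′; _⟨$⟩ʳ_)
open import Data.Vec using (Vec; []; _∷_; lookup; tabulate)
open import Data.List using (List; length)
open import Data.List.Membership.Propositional using (_∈_)
open import Data.List.Relation.Unary.Unique.Propositional using (Unique)
open import Data.Product using (Σ; _×_; _,_; proj₁; proj₂; ∃)
open import Data.Sum using (_⊎_)
open import Relation.Binary.PropositionalEquality using (_≡_)
open import Function.Bundles using (_⇔_)

-- A candidate family {(l_h, r_h)}_{h=1}^n, stored as a vector of n pairs;
-- index h : Fin n (0-based) corresponds to h+1 in the paper.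
Fam : ℕ → Set
Fam n = Vec (ℕ × ℕ) n

l : ∀ {n} → Fam n → Fin n → ℕ
l θ h = proj₁ (lookup θ h)

r : ∀ {n} → Fam n → Fin n → ℕ
r θ h = proj₂ (lookup θ h)

record IsPP (n : ℕ) (θ : Fam n) : Set where
  field
    l-range : ∀ h → 1 ≤ l θ h × l θ h ≤ 2 * n
    r-range : ∀ h → 1 ≤ r θ h × r θ h ≤ 2 * n
    cover   : ∀ m → 1 ≤ m → m ≤ 2 * n → ∃ λ h → l θ h ≡ m ⊎ r θ h ≡ m
    l<r     : ∀ h → l θ h < r θ h
    l-incr  : ∀ h k → h Fin.< k → l θ h < l θ k

NonCrossing : ∀ {n} → Fam n → Set
NonCrossing θ = ∀ h k → h Fin.< k → (l θ k < r θ h ⇔ r θ k < r θ h)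

IsNCPP : (n : ℕ) → Fam n → Set
IsNCPP n θ = IsPP n θ × NonCrossing θ

-- l_n (the last left endpoint); only used for n ≥ 1
lastL : ∀ {n} → Fam n → ℕ
lastL [] = 0
lastL (x ∷ []) = proj₁ x
lastL (x ∷ y ∷ xs) = lastL (y ∷ xs)

IsPPk : (n k : ℕ) → Fam n → Set
IsPPk n k θ = IsPP n θ × (2 * n ∸ lastL θ ≡ k)

IsNCPPk : (n k : ℕ) → Fam n → Set
IsNCPPk n k θ = IsNCPP n θ × (2 * n ∸ lastL θ ≡ k)

HasSize : ∀ {A : Set} → (A → Set) → ℕ → Set
HasSize {A} P m = Σ (List A) λ xs → Unique xs × length xs ≡ m × (∀ x → (x ∈ xs ⇔ P x))

Bij : ∀ {A B : Set} → (A → Set) → (B → Set) → Set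
Bij {A} {B} P Q =
  Σ (A → B) λ f → Σ (B → A) λ g →
    (∀ x → P x → Q (f x)) × (∀ y → Q y → P (g y)) ×
    (∀ x → P x → g (f x) ≡ x) × (∀ y → Q y → f (g y) ≡ y)

nested : (n : ℕ) → Fam n
nested n = tabulate λ h → (suc (toℕ h) , 2 * n + 1 ∸ suc (toℕ h))

permFam : (n : ℕ) → Permutation′ n → Fam n
permFam n σ = tabulate λ h → (suc (toℕ h) , n + suc (toℕ (σ ⟨$⟩ʳ h)))

-- oddFact m = (2m-1)!!, with oddFact 0 = (-1)!! = 1
oddFact : ℕ → ℕ
oddFact zero = 1
oddFact (suc m) = (2 * m + 1) * oddFact m

catalan : ℕ → ℕ
catalan m = (2 * m C m) / suc m

sumCount : ℕ → ℕ → (ℕ → ℕ) → ℕ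
sumCount a zero f = 0
sumCount a (suc c) f = f a + sumCount (suc a) c f

sumFromTo : ℕ → ℕ → (ℕ → ℕ) → ℕ
sumFromTo a b f = sumCount a (suc b ∸ a) f

-- A pair partition is handled by inserting or deleting one pair and relabelling the other
-- points. Deleting the first pair (1, q) of an element of PP(2n) leaves an element of PP(2n−2),
-- with 2n−1 possible q; this gives (2n−1)!!, and n! for PP_n(2n), where q ranges over
-- n+1, …, 2n. In NCPP_k(2n) the last pair must be (2n−k, 2n−k+1); deleting it lands in
-- NCPP_h(2n−2) for some h ≥ k−1, which gives the recursion and bijections of 2) and 3). The
-- numbers defined by that recursion satisfy the ballot formula
-- |NCPP_{c+1}(2(a+c+1))| = C(2a+c, a) − C(2a+c, a−1), whose case c = 0 is the Catalan number.
-- In PP_n(2n) the left endpoints are 1, …, n and the right endpoints a permutation of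
-- n+1, …, 2n, which non-crossing forces to be decreasing.

module Submission where

open import Defs
open import Data.Nat using (ℕ; zero; suc; _+_; _*_; _∸_; _≤_; _<_; z≤n; s≤s; NonZero; _!; _<?_)
open import Data.Nat.Properties
open import Data.Nat.DivMod using (_/_; m*n/n≡m)
open import Data.Nat.Combinatorics
  using (_C_; nCk+nC[k+1]≡[n+1]C[k+1]; nC1≡n; nCk≡nC[n∸k])
open import Data.Nat.Tactic.RingSolver using (solve-∀)
open import Data.Product using (Σ; ∃; _×_; _,_; proj₁; proj₂)
open import Data.Sum using (_⊎_; inj₁; inj₂; [_,_]′)
import Data.Sum.Properties as ⊎
open import Data.Empty using (⊥; ⊥-elim)
open import Relation.Nullary using (¬_; Dec; yes; no)
open import Relation.Binary.Definitions using (tri<; tri≈; tri>)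
open import Relation.Binary.PropositionalEquality
  using (_≡_; _≢_; refl; sym; trans; cong; cong₂; subst; subst₂; module ≡-Reasoning)
open import Function.Base using (_∘_)
open import Data.Fin as Fin using (Fin; toℕ; fromℕ; fromℕ<; punchIn; punchOut; zero; suc)
import Data.Fin.Properties as FinP
open import Data.Fin.Permutation using (Permutation′; permutation; reverse; _⟨$⟩ʳ_; _⟨$⟩ˡ_; inverseʳ)
open import Data.Vec as Vec using (Vec; []; _∷_; lookup; insertAt; removeAt)
import Data.Vec.Properties as VecP
open import Function.Bundles using (_⇔_; mk⇔; Equivalence)
open Equivalence using (to; from)
import Function.Properties.Equivalence as ⇔
open import Data.List as List using (List; _++_)
import Data.List.Properties as List
open import Data.List.Membership.Propositional using (_∈_)
import Data.List.Membership.Propositional.Properties as ∈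
open import Data.List.Relation.Unary.Any using (here)
open import Data.List.Relation.Unary.All using ([])
open import Data.List.Relation.Unary.AllPairs using ([]; _∷_)
import Data.List.Relation.Unary.Unique.Propositional.Properties as Unique

open ≡-Reasoning

nC0≡1 : ∀ n → n C 0 ≡ 1
nC0≡1 zero    = refl
nC0≡1 (suc n) = refl

pascal : ∀ n k → suc n C suc k ≡ n C k + n C suc k
pascal n k = sym (nCk+nC[k+1]≡[n+1]C[k+1] n k)

[k+1]*[n+1]C[k+1]≡[n+1]*nCk : ∀ n k → suc k * (suc n C suc k) ≡ suc n * (n C k)
[k+1]*[n+1]C[k+1]≡[n+1]*nCk zero    zero    = refl
[k+1]*[n+1]C[k+1]≡[n+1]*nCk zero    (suc k) = *-zeroʳ (suc (suc k))
[k+1]*[n+1]C[k+1]≡[n+1]*nCk (suc n) zero    = begin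
  1 * (suc (suc n) C 1)  ≡⟨ *-identityˡ _ ⟩
  suc (suc n) C 1        ≡⟨ nC1≡n (suc (suc n)) ⟩
  suc (suc n)            ≡⟨ sym (*-identityʳ _) ⟩
  suc (suc n) * 1        ≡⟨ cong (suc (suc n) *_) (sym (nC0≡1 (suc n))) ⟩
  suc (suc n) * (suc n C 0) ∎
[k+1]*[n+1]C[k+1]≡[n+1]*nCk (suc n) (suc k) = begin
  suc (suc k) * (suc (suc n) C suc (suc k))
    ≡⟨ cong (suc (suc k) *_) (pascal (suc n) (suc k)) ⟩
  suc (suc k) * (suc n C suc k + suc n C suc (suc k))
    ≡⟨ *-distribˡ-+ (suc (suc k)) (suc n C suc k) _ ⟩
  suc (suc k) * (suc n C suc k) + suc (suc k) * (suc n C suc (suc k))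
    ≡⟨ cong (suc (suc k) * (suc n C suc k) +_) ([k+1]*[n+1]C[k+1]≡[n+1]*nCk n (suc k)) ⟩
  (suc n C suc k + suc k * (suc n C suc k)) + suc n * (n C suc k)
    ≡⟨ cong (λ x → (suc n C suc k + x) + suc n * (n C suc k)) ([k+1]*[n+1]C[k+1]≡[n+1]*nCk n k) ⟩
  (suc n C suc k + suc n * (n C k)) + suc n * (n C suc k)
    ≡⟨ +-assoc (suc n C suc k) _ _ ⟩
  suc n C suc k + (suc n * (n C k) + suc n * (n C suc k))
    ≡⟨ cong (suc n C suc k +_) (sym (*-distribˡ-+ (suc n) (n C k) _)) ⟩
  suc n C suc k + suc n * (n C k + n C suc k)
    ≡⟨ cong (λ x → suc n C suc k + suc n * x) (sym (pascal n k)) ⟩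
  suc (suc n) * (suc n C suc k) ∎

C-sym : ∀ a b → (a + b) C a ≡ (a + b) C b
C-sym a b = trans (nCk≡nC[n∸k] (m≤m+n a b)) (cong ((a + b) C_) (m+n∸m≡n a b))

sumFromTo-unfold : ∀ k n f → k ≤ n → sumFromTo k n f ≡ f k + sumFromTo (suc k) n f
sumFromTo-unfold k n f k≤n rewrite +-∸-assoc 1 k≤n = refl

sumFromTo-empty : ∀ k n f → n < k → sumFromTo k n f ≡ 0
sumFromTo-empty k n f n<k rewrite m≤n⇒m∸n≡0 n<k = refl

sumCount-const : ∀ a c s → sumCount a c (λ _ → s) ≡ c * s
sumCount-const a zero    s = refl
sumCount-const a (suc c) s = cong (s +_) (sumCount-const (suc a) c s)

-- The numbers |NCPP_k(2n)|

ncppCount : ℕ → ℕ → ℕ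
ncppCount zero    zero    = 1
ncppCount zero    (suc k) = 0
ncppCount (suc n) zero    = 0
ncppCount (suc n) (suc k) = sumFromTo k n (ncppCount n)

ncppCount-diag : ∀ n → ncppCount n n ≡ 1
ncppCount-diag zero    = refl
ncppCount-diag (suc n) = begin
  sumFromTo n n (ncppCount n)                          ≡⟨ sumFromTo-unfold n n _ ≤-refl ⟩
  ncppCount n n + sumFromTo (suc n) n (ncppCount n)    ≡⟨ cong₂ _+_ (ncppCount-diag n) (sumFromTo-empty (suc n) n _ ≤-refl) ⟩
  1                                                    ∎

ncppCount-subdiag : ∀ n → ncppCount (suc n) n ≡ n
ncppCount-subdiag zero    = refl
ncppCount-subdiag (suc n) = begin
  sumFromTo n (suc n) (ncppCount (suc n))
    ≡⟨ sumFromTo-unfold n (suc n) _ (n≤1+n n) ⟩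
  ncppCount (suc n) n + sumFromTo (suc n) (suc n) (ncppCount (suc n))
    ≡⟨ cong₂ _+_ (ncppCount-subdiag n) (ncppCount-diag (suc (suc n))) ⟩
  n + 1
    ≡⟨ +-comm n 1 ⟩
  suc n ∎

ncppCount-2≡1 : ∀ n → ncppCount (suc (suc n)) 2 ≡ ncppCount (suc (suc n)) 1
ncppCount-2≡1 n = sym (sumFromTo-unfold 0 (suc n) (ncppCount (suc n)) z≤n)

-- The ballot formula ncppCount (a+c+1) (c+1) = C(2a+c, a) − C(2a+c, a−1), with the
-- subtrahend moved to the left; ballotDefect a c is C(2a+c, a−1), taken to be 0 for a = 0.

ballotDefect : ℕ → ℕ → ℕ
ballotDefect zero    c = 0
ballotDefect (suc a) c = (suc a + (suc a + c)) C a

ballotDefect-split₀ : ∀ a → ballotDefect (suc a) 0 ≡ ballotDefect a 1 + (a + suc a) C a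
ballotDefect-split₀ zero    = refl
ballotDefect-split₀ (suc a) = begin
  (suc (suc a) + (suc (suc a) + 0)) C suc a
    ≡⟨ cong (_C suc a) (2a+2+0≡1+[a+1+[a+1+1]] a) ⟩
  suc (suc a + (suc a + 1)) C suc a
    ≡⟨ pascal (suc a + (suc a + 1)) a ⟩
  (suc a + (suc a + 1)) C a + (suc a + (suc a + 1)) C suc a
    ≡⟨ cong (λ x → (suc a + (suc a + 1)) C a + x C suc a) (cong (suc a +_) (+-comm (suc a) 1)) ⟩
  (suc a + (suc a + 1)) C a + (suc a + suc (suc a)) C suc a ∎
  where
  2a+2+0≡1+[a+1+[a+1+1]] : ∀ a → suc (suc a) + (suc (suc a) + 0) ≡ suc (suc a + (suc a + 1))
  2a+2+0≡1+[a+1+[a+1+1]] = solve-∀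

ncppCount-split : ∀ a c → ncppCount (suc (suc a + suc c)) (suc (suc c))
  ≡ ncppCount (suc (suc a + c)) (suc c) + ncppCount (suc (a + suc (suc c))) (suc (suc (suc c)))
ncppCount-split a c = begin
  sumFromTo (suc c) n (ncppCount n)
    ≡⟨ sumFromTo-unfold (suc c) n (ncppCount n) (s≤s (≤-trans (n≤1+n c) (m≤n+m (suc c) a))) ⟩
  ncppCount n (suc c) + sumFromTo (suc (suc c)) n (ncppCount n)
    ≡⟨ cong₂ _+_ (cong (λ x → ncppCount (suc x) (suc c)) (+-suc a c))
                 (cong (λ x → sumFromTo (suc (suc c)) x (ncppCount x)) (sym (+-suc a (suc c)))) ⟩
  ncppCount (suc (suc a + c)) (suc c) + ncppCount (suc (a + suc (suc c))) (suc (suc (suc c))) ∎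
  where n = suc a + suc c

C-split : ∀ a c j → (suc a + (suc a + suc c)) C suc j
  ≡ (suc a + (suc a + c)) C suc j + (a + (a + suc (suc c))) C j
C-split a c j = begin
  suc (a + (suc a + suc c)) C suc j
    ≡⟨ pascal (a + (suc a + suc c)) j ⟩
  (a + (suc a + suc c)) C j + (a + (suc a + suc c)) C suc j
    ≡⟨ +-comm ((a + (suc a + suc c)) C j) _ ⟩
  (a + (suc a + suc c)) C suc j + (a + (suc a + suc c)) C j
    ≡⟨ cong₂ (λ x y → x C suc j + y C j) (a+[1+a+1+c]≡1+a+[1+a+c] a c) (a+[1+a+1+c]≡a+[a+2+c] a c) ⟩
  (suc a + (suc a + c)) C suc j + (a + (a + suc (suc c))) C j ∎
  where
  a+[1+a+1+c]≡1+a+[1+a+c] : ∀ a c → a + (suc a + suc c) ≡ suc a + (suc a + c)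
  a+[1+a+1+c]≡1+a+[1+a+c] = solve-∀
  a+[1+a+1+c]≡a+[a+2+c] : ∀ a c → a + (suc a + suc c) ≡ a + (a + suc (suc c))
  a+[1+a+1+c]≡a+[a+2+c] = solve-∀

ballotDefect-split : ∀ a c → ballotDefect (suc a) (suc c) ≡ ballotDefect (suc a) c + ballotDefect a (suc (suc c))
ballotDefect-split zero    c = refl
ballotDefect-split (suc a) c = C-split (suc a) c a

ballot : ∀ a c → ncppCount (suc (a + c)) (suc c) + ballotDefect a c ≡ (a + (a + c)) C a
ballot zero    c       = trans (+-identityʳ _) (trans (ncppCount-diag (suc c)) (sym (nC0≡1 c)))
ballot (suc a) zero    = begin
  ncppCount (suc (suc a + 0)) 1 + ballotDefect (suc a) 0
    ≡⟨ cong₂ _+_ count-step (ballotDefect-split₀ a) ⟩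
  ncppCount (suc (a + 1)) 2 + (ballotDefect a 1 + M C a)
    ≡⟨ sym (+-assoc (ncppCount (suc (a + 1)) 2) _ _) ⟩
  (ncppCount (suc (a + 1)) 2 + ballotDefect a 1) + M C a
    ≡⟨ cong₂ _+_ (ballot a 1) (C-sym a (suc a)) ⟩
  (a + (a + 1)) C a + M C suc a
    ≡⟨ cong (λ x → (a + x) C a + M C suc a) (+-comm a 1) ⟩
  M C a + M C suc a
    ≡⟨ sym (pascal M a) ⟩
  suc M C suc a
    ≡⟨ cong (λ x → suc (a + x) C suc a) (sym (+-identityʳ (suc a))) ⟩
  (suc a + (suc a + 0)) C suc a ∎
  where
  M = a + suc a
  count-step : ncppCount (suc (suc a + 0)) 1 ≡ ncppCount (suc (a + 1)) 2
  count-step = begin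
    ncppCount (suc (suc a + 0)) 1 ≡⟨ cong (λ x → ncppCount (suc x) 1) (+-identityʳ (suc a)) ⟩
    ncppCount (suc (suc a)) 1     ≡⟨ sumFromTo-unfold 0 (suc a) (ncppCount (suc a)) z≤n ⟩
    ncppCount (suc (suc a)) 2     ≡⟨ cong (λ x → ncppCount (suc x) 2) (+-comm 1 a) ⟩
    ncppCount (suc (a + 1)) 2     ∎
ballot (suc a) (suc c) = begin
  V (suc a) (suc c) + ballotDefect (suc a) (suc c)
    ≡⟨ cong₂ _+_ (ncppCount-split a c) (ballotDefect-split a c) ⟩
  (V (suc a) c + V a (suc (suc c))) + (ballotDefect (suc a) c + ballotDefect a (suc (suc c)))
    ≡⟨ +-interchange (V (suc a) c) _ _ _ ⟩
  (V (suc a) c + ballotDefect (suc a) c) + (V a (suc (suc c)) + ballotDefect a (suc (suc c)))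
    ≡⟨ cong₂ _+_ (ballot (suc a) c) (ballot a (suc (suc c))) ⟩
  (suc a + (suc a + c)) C suc a + (a + (a + suc (suc c))) C a
    ≡⟨ sym (C-split a c a) ⟩
  (suc a + (suc a + suc c)) C suc a ∎
  where
  V : ℕ → ℕ → ℕ
  V a c = ncppCount (suc (a + c)) (suc c)
  +-interchange : ∀ w x y z → (w + x) + (y + z) ≡ (w + y) + (x + z)
  +-interchange = solve-∀

[j+1]*[2j+2]C[j+1]≡[j+2]*[2j+2]Cj : ∀ j → suc j * ((suc j + suc j) C suc j) ≡ suc (suc j) * ((suc j + suc j) C j)
[j+1]*[2j+2]C[j+1]≡[j+2]*[2j+2]Cj j = begin
  suc j * (suc M C suc j)                ≡⟨ [k+1]*[n+1]C[k+1]≡[n+1]*nCk M j ⟩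
  suc M * (M C j)                        ≡⟨ cong (suc M *_) (C-sym j (suc j)) ⟩
  suc M * (M C suc j)                    ≡⟨ sym ([k+1]*[n+1]C[k+1]≡[n+1]*nCk M (suc j)) ⟩
  suc (suc j) * (suc M C suc (suc j))    ≡⟨ cong (λ x → suc (suc j) * (x C suc (suc j))) (sym (+-suc j (suc j))) ⟩
  suc (suc j) * ((j + suc (suc j)) C suc (suc j)) ≡⟨ cong (suc (suc j) *_) (sym (C-sym j (suc (suc j)))) ⟩
  suc (suc j) * ((j + suc (suc j)) C j)  ≡⟨ cong (λ x → suc (suc j) * (x C j)) (+-suc j (suc j)) ⟩
  suc (suc j) * (suc M C j)              ∎
  where M = j + suc j

-- The ballot formula at c = 0 reads V + W = B, and (j+1) B = (j+2) W; hence (j+2) V = B.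
[m+1]*ncppCount[m+1,1]≡[2m]Cm : ∀ m → suc m * ncppCount (suc m) 1 ≡ (m + m) C m
[m+1]*ncppCount[m+1,1]≡[2m]Cm zero    = refl
[m+1]*ncppCount[m+1,1]≡[2m]Cm (suc j) = +-cancelʳ-≡ (suc (suc j) * W) _ _ (begin
  suc (suc j) * V + suc (suc j) * W  ≡⟨ sym (*-distribˡ-+ (suc (suc j)) V W) ⟩
  suc (suc j) * (V + W)              ≡⟨ cong (suc (suc j) *_) V+W≡B ⟩
  B + suc j * B                      ≡⟨ cong (B +_) ([j+1]*[2j+2]C[j+1]≡[j+2]*[2j+2]Cj j) ⟩
  B + suc (suc j) * W                ∎)
  where
  V = ncppCount (suc (suc j)) 1
  W = (suc j + suc j) C j
  B = (suc j + suc j) C suc j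
  V+W≡B : V + W ≡ B
  V+W≡B = subst (λ x → ncppCount (suc x) 1 + (suc j + x) C j ≡ (suc j + x) C suc j)
                (+-identityʳ (suc j)) (ballot (suc j) 0)

ncppCount-catalan : ∀ m → ncppCount (suc m) 1 ≡ catalan m
ncppCount-catalan m = begin
  ncppCount (suc m) 1                  ≡⟨ sym (m*n/n≡m (ncppCount (suc m) 1) (suc m)) ⟩
  ncppCount (suc m) 1 * suc m / suc m  ≡⟨ cong (_/ suc m) (*-comm (ncppCount (suc m) 1) (suc m)) ⟩
  suc m * ncppCount (suc m) 1 / suc m  ≡⟨ cong (_/ suc m) ([m+1]*ncppCount[m+1,1]≡[2m]Cm m) ⟩
  ((m + m) C m) / suc m                ≡⟨ cong (λ x → ((m + x) C m) / suc m) (sym (+-identityʳ m)) ⟩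
  catalan m                            ∎

Image : ∀ {A B : Set} → (B → A) → (B → Set) → A → Set
Image g Q x = ∃ λ y → Q y × x ≡ g y

module _ {A : Set} where

  HasSize-cong : ∀ {P Q : A → Set} {m} → (∀ x → P x ⇔ Q x) → HasSize P m → HasSize Q m
  HasSize-cong P⇔Q (xs , uniq , len , mem) =
    xs , uniq , len , λ x → mk⇔ (to (P⇔Q x) ∘ to (mem x)) (from (mem x) ∘ from (P⇔Q x))

  HasSize-∅ : ∀ {P : A → Set} → (∀ x → ¬ P x) → HasSize P 0
  HasSize-∅ ¬P = List.[] , [] , refl , λ x → mk⇔ (λ ()) (⊥-elim ∘ ¬P x)

  HasSize-singleton : ∀ {P : A → Set} (a : A) → (∀ x → P x ⇔ x ≡ a) → HasSize P 1
  HasSize-singleton a P⇔≡a =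
    List.[ a ] , [] ∷ [] , refl ,
    λ x → mk⇔ (λ { (here refl) → from (P⇔≡a a) refl }) (here ∘ to (P⇔≡a x))

  HasSize-⊎ : ∀ {P Q : A → Set} {a b} → HasSize P a → HasSize Q b →
              (∀ x → P x → Q x → ⊥) → HasSize (λ x → P x ⊎ Q x) (a + b)
  HasSize-⊎ {P} {Q} (xs , uxs , lxs , mxs) (ys , uys , lys , mys) disjoint =
    xs ++ ys ,
    Unique.++⁺ uxs uys (λ { (i , j) → disjoint _ (to (mxs _) i) (to (mys _) j) }) ,
    trans (List.length-++ xs) (cong₂ _+_ lxs lys) ,
    λ x → mk⇔ (out x) (into x)
    where
    out : ∀ x → x ∈ xs ++ ys → P x ⊎ Q x
    out x i with ∈.∈-++⁻ xs i
    ... | inj₁ i∈xs = inj₁ (to (mxs x) i∈xs)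
    ... | inj₂ i∈ys = inj₂ (to (mys x) i∈ys)
    into : ∀ x → P x ⊎ Q x → x ∈ xs ++ ys
    into x (inj₁ p) = ∈.∈-++⁺ˡ (from (mxs x) p)
    into x (inj₂ q) = ∈.∈-++⁺ʳ xs (from (mys x) q)

  HasSize-image : ∀ {B : Set} {Q : B → Set} {s} (g : B → A) (f : A → B) → (∀ y → f (g y) ≡ y) →
                  HasSize Q s → HasSize (Image g Q) s
  HasSize-image {Q = Q} g f f∘g≗id (ys , uys , lys , mys) =
    List.map g ys ,
    Unique.map⁺ (λ {x} {y} gx≡gy → trans (sym (f∘g≗id x)) (trans (cong f gx≡gy) (f∘g≗id y))) uys ,
    trans (List.length-map g ys) lys ,
    λ x → mk⇔ (out x) (into x)
    where
    out : ∀ x → x ∈ List.map g ys → Image g Q x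
    out x i with ∈.∈-map⁻ g i
    ... | y , j , x≡gy = y , to (mys y) j , x≡gy
    into : ∀ x → Image g Q x → x ∈ List.map g ys
    into x (y , q , refl) = ∈.∈-map⁺ g (from (mys y) q)

  module _ (P : ℕ → A → Set) (b : ℕ → ℕ) (size : ∀ h → HasSize (P h) (b h))
           (P-disjoint : ∀ h h′ x → P h x → P h′ x → h ≡ h′) where

    HasSize-⋃-count : ∀ a c → HasSize (λ x → ∃ λ h → a ≤ h × h < a + c × P h x) (sumCount a c b)
    HasSize-⋃-count a zero    = HasSize-∅ λ { x (h , a≤h , h<a+0 , _) → <-irrefl refl (≤-<-trans a≤h (subst (h <_) (+-identityʳ a) h<a+0)) }
    HasSize-⋃-count a (suc c) = HasSize-cong split (HasSize-⊎ (size a) (HasSize-⋃-count (suc a) c) disjoint)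
      where
      disjoint : ∀ x → P a x → (∃ λ h → suc a ≤ h × h < suc a + c × P h x) → ⊥
      disjoint x p (h , a<h , _ , q) = <-irrefl (P-disjoint a h x p q) a<h
      split : ∀ x → (P a x ⊎ (∃ λ h → suc a ≤ h × h < suc a + c × P h x)) ⇔ (∃ λ h → a ≤ h × h < a + suc c × P h x)
      split x = mk⇔ join cases
        where
        join : P a x ⊎ (∃ λ h → suc a ≤ h × h < suc a + c × P h x) → ∃ λ h → a ≤ h × h < a + suc c × P h x
        join (inj₁ p)                  = a , ≤-refl , subst (a <_) (sym (+-suc a c)) (s≤s (m≤m+n a c)) , p
        join (inj₂ (h , a<h , h< , p)) = h , <⇒≤ a<h , subst (h <_) (sym (+-suc a c)) h< , p
        cases : (∃ λ h → a ≤ h × h < a + suc c × P h x) → P a x ⊎ (∃ λ h → suc a ≤ h × h < suc a + c × P h x)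
        cases (h , a≤h , h< , p) with a ≟ h
        ... | yes refl = inj₁ p
        ... | no a≢h   = inj₂ (h , ≤∧≢⇒< a≤h a≢h , subst (h <_) (+-suc a c) h< , p)

    HasSize-⋃ : ∀ a c → HasSize (λ x → ∃ λ h → a ≤ h × h ≤ c × P h x) (sumFromTo a c b)
    HasSize-⋃ a c = HasSize-cong bounds (HasSize-⋃-count a (suc c ∸ a))
      where
      bounds : ∀ x → (∃ λ h → a ≤ h × h < a + (suc c ∸ a) × P h x) ⇔ (∃ λ h → a ≤ h × h ≤ c × P h x)
      bounds x with a ≤? suc c
      ... | yes a≤1+c = mk⇔ (λ { (h , a≤h , h< , p) → h , a≤h , ≤-pred (subst (h <_) (m+[n∸m]≡n a≤1+c) h<) , p })
                            (λ { (h , a≤h , h≤ , p) → h , a≤h , subst (h <_) (sym (m+[n∸m]≡n a≤1+c)) (s≤s h≤) , p })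
      ... | no a≰1+c = mk⇔ (λ { (h , a≤h , h<a+0 , _) → ⊥-elim (<-irrefl refl (≤-<-trans a≤h
                                  (subst (h <_) (trans (cong (a +_) (m≤n⇒m∸n≡0 (<⇒≤ (≰⇒> a≰1+c)))) (+-identityʳ a)) h<a+0))) })
                           (λ { (h , a≤h , h≤c , _) → ⊥-elim (a≰1+c (≤-trans a≤h (m≤n⇒m≤1+n h≤c))) })

  image⇒Bij : ∀ {B : Set} {P : A → Set} {Q : B → Set} (f : A → B) (g : B → A) → (∀ y → f (g y) ≡ y) →
              (∀ x → P x ⇔ Image g Q x) → Bij P Q
  image⇒Bij {Q = Q} f g f∘g≗id P⇔image = f , g , Q∘f , P∘g , g∘f , λ y _ → f∘g≗id y
    where
    Q∘f : ∀ x → _ → Q (f x)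
    Q∘f x p with to (P⇔image x) p
    ... | y , q , refl = subst Q (sym (f∘g≗id y)) q
    P∘g : ∀ y → Q y → _
    P∘g y q = from (P⇔image (g y)) (y , q , refl)
    g∘f : ∀ x → _ → g (f x) ≡ x
    g∘f x p with to (P⇔image x) p
    ... | y , q , refl = cong g (f∘g≗id y)

-- For p < q, skip p q enumerates the positive integers other than p and q: it relabels
-- the old points when a new pair (p, q) is inserted, and unskip p q undoes it.
skip : ℕ → ℕ → ℕ → ℕ
skip p q v with v <? p
... | yes _ = v
... | no _ with suc v <? q
...   | yes _ = suc v
...   | no _ = suc (suc v)

skip-below : ∀ {p q v} → v < p → skip p q v ≡ v
skip-below {p} {q} {v} h with v <? p
... | yes _ = refl
... | no ¬h = ⊥-elim (¬h h)

skip-between : ∀ {p q v} → p ≤ v → suc v < q → skip p q v ≡ suc v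
skip-between {p} {q} {v} h h′ with v <? p
... | yes x = ⊥-elim (<-irrefl refl (<-≤-trans x h))
... | no _ with suc v <? q
...   | yes _ = refl
...   | no ¬h = ⊥-elim (¬h h′)

skip-above : ∀ {p q v} → p ≤ v → q ≤ suc v → skip p q v ≡ suc (suc v)
skip-above {p} {q} {v} h h′ with v <? p
... | yes x = ⊥-elim (<-irrefl refl (<-≤-trans x h))
... | no _ with suc v <? q
...   | yes x = ⊥-elim (<-irrefl refl (<-≤-trans x h′))
...   | no _ = refl

data SkipView (p q v : ℕ) : ℕ → Set where
  lo : v < p → SkipView p q v v
  mid : p ≤ v → suc v < q → SkipView p q v (suc v)
  hi : p ≤ v → q ≤ suc v → SkipView p q v (suc (suc v))

skipView : ∀ p q v → SkipView p q v (skip p q v)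
skipView p q v = go (v <? p) (suc v <? q)
  where
  go : Dec (v < p) → Dec (suc v < q) → SkipView p q v (skip p q v)
  go (yes x) _ = subst (SkipView p q v) (sym (skip-below x)) (lo x)
  go (no ¬x) (yes y) = subst (SkipView p q v) (sym (skip-between (≮⇒≥ ¬x) y)) (mid (≮⇒≥ ¬x) y)
  go (no ¬x) (no ¬y) = subst (SkipView p q v) (sym (skip-above (≮⇒≥ ¬x) (≮⇒≥ ¬y))) (hi (≮⇒≥ ¬x) (≮⇒≥ ¬y))

skip-mono-< : ∀ {p q v w} → v < w → skip p q v < skip p q w
skip-mono-< {p} {q} {v} {w} vw with skip p q v | skipView p q v | skip p q w | skipView p q w
... | _ | lo a | _ | lo b = vw
... | _ | lo a | _ | mid b c = m<n⇒m<1+n vw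
... | _ | lo a | _ | hi b c = m<n⇒m<1+n (m<n⇒m<1+n vw)
... | _ | mid a b | _ | lo c = ⊥-elim (<-irrefl refl (≤-<-trans a (<-trans vw c)))
... | _ | mid a b | _ | mid c d = s≤s vw
... | _ | mid a b | _ | hi c d = s≤s (m<n⇒m<1+n vw)
... | _ | hi a b | _ | lo c = ⊥-elim (<-irrefl refl (≤-<-trans a (<-trans vw c)))
... | _ | hi a b | _ | mid c d = ⊥-elim (<-irrefl refl (<-trans (n<1+n w) (<-≤-trans d (≤-trans b vw))))
... | _ | hi a b | _ | hi c d = s≤s (s≤s vw)

skip-cancel-< : ∀ {p q v w} → skip p q v < skip p q w → v < w
skip-cancel-< {p} {q} {v} {w} h with <-cmp v w
... | tri< v<w _ _ = v<w
... | tri≈ _ refl _ = ⊥-elim (<-irrefl refl h)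
... | tri> _ _ w<v = ⊥-elim (<-asym h (skip-mono-< {p} {q} w<v))

skip-injective : ∀ {p q v w} → skip p q v ≡ skip p q w → v ≡ w
skip-injective {p} {q} {v} {w} e with <-cmp v w
... | tri< a _ _ = ⊥-elim (<-irrefl e (skip-mono-< {p} {q} a))
... | tri≈ _ b _ = b
... | tri> _ _ c = ⊥-elim (<-irrefl (sym e) (skip-mono-< {p} {q} c))

skip≢p : ∀ {p q v} → skip p q v ≢ p
skip≢p {p} {q} {v} with skip p q v | skipView p q v
... | _ | lo a = λ e → <-irrefl e a
... | _ | mid a b = λ e → <-irrefl (sym e) (s≤s a)
... | _ | hi a b = λ e → <-irrefl (sym e) (m<n⇒m<1+n (s≤s a))

skip≢q : ∀ {p q v} → p < q → skip p q v ≢ q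
skip≢q {p} {q} {v} pq with skip p q v | skipView p q v
... | _ | lo a = λ e → <-irrefl e (<-trans a pq)
... | _ | mid a b = λ e → <-irrefl e b
... | _ | hi a b = λ e → <-irrefl (sym e) (s≤s b)

v≤skip : ∀ {p q v} → v ≤ skip p q v
v≤skip {p} {q} {v} with skip p q v | skipView p q v
... | _ | lo a = ≤-refl
... | _ | mid a b = n≤1+n v
... | _ | hi a b = ≤-trans (n≤1+n v) (n≤1+n (suc v))

skip≤2+v : ∀ {p q v} → skip p q v ≤ suc (suc v)
skip≤2+v {p} {q} {v} with skip p q v | skipView p q v
... | _ | lo a = ≤-trans (n≤1+n v) (n≤1+n (suc v))
... | _ | mid a b = n≤1+n (suc v)
... | _ | hi a b = ≤-refl

skip<p⇒v<p : ∀ {p q v} → skip p q v < p → v < p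
skip<p⇒v<p {p} {q} {v} with skip p q v | skipView p q v
... | _ | lo a = λ _ → a
... | _ | mid a b = λ h → ⊥-elim (<-irrefl refl (≤-<-trans a (<-trans (n<1+n v) h)))
... | _ | hi a b = λ h → ⊥-elim (<-irrefl refl (≤-<-trans a (<-trans (n<1+n v) (<-trans (n<1+n (suc v)) h))))

p≤v⇒p<skip : ∀ {p q v} → p ≤ v → p < skip p q v
p≤v⇒p<skip {p} {q} {v} p≤v = <-≤-trans (s≤s p≤v) (1+v≤skip p≤v)
  where
  1+v≤skip : p ≤ v → suc v ≤ skip p q v
  1+v≤skip h with skip p q v | skipView p q v
  ... | _ | lo a = ⊥-elim (<-irrefl refl (<-≤-trans a h))
  ... | _ | mid a b = ≤-refl
  ... | _ | hi a b = n≤1+n (suc v)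

1≤skip⇒1≤v : ∀ {p q v} → 1 ≤ p → 1 ≤ skip p q v → 1 ≤ v
1≤skip⇒1≤v {p} {q} {v} h with skip p q v | skipView p q v
... | _ | lo a = λ x → x
... | _ | mid a b = λ _ → ≤-trans h a
... | _ | hi a b = λ _ → ≤-trans h a

skip≤2+N⇒v≤N : ∀ {p q v} N → p < q → q ≤ suc (suc N) → skip p q v ≤ suc (suc N) → v ≤ N
skip≤2+N⇒v≤N {p} {q} {v} N pq qN with skip p q v | skipView p q v
... | _ | lo a = λ _ → ≤-pred (≤-pred (≤-trans (s≤s a) (≤-trans pq qN)))
... | _ | mid a b = λ _ → ≤-pred (≤-pred (≤-trans b qN))
... | _ | hi a b = λ h → ≤-pred (≤-pred h)

unskip : ℕ → ℕ → ℕ → ℕ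
unskip p q m with m <? p
... | yes _ = m
... | no _ with m <? q
...   | yes _ = m ∸ 1
...   | no _ = m ∸ 2

unskip-below : ∀ {p q m} → m < p → unskip p q m ≡ m
unskip-below {p} {q} {m} h with m <? p
... | yes _ = refl
... | no ¬h = ⊥-elim (¬h h)

unskip-between : ∀ {p q m} → p ≤ m → m < q → unskip p q m ≡ m ∸ 1
unskip-between {p} {q} {m} h h′ with m <? p
... | yes x = ⊥-elim (<-irrefl refl (<-≤-trans x h))
... | no _ with m <? q
...   | yes _ = refl
...   | no ¬h = ⊥-elim (¬h h′)

unskip-above : ∀ {p q m} → p ≤ m → q ≤ m → unskip p q m ≡ m ∸ 2
unskip-above {p} {q} {m} h h′ with m <? p
... | yes x = ⊥-elim (<-irrefl refl (<-≤-trans x h))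
... | no _ with m <? q
...   | yes x = ⊥-elim (<-irrefl refl (<-≤-trans x h′))
...   | no _ = refl

unskip∘skip : ∀ {p q v} → unskip p q (skip p q v) ≡ v
unskip∘skip {p} {q} {v} with skip p q v | skipView p q v
... | _ | lo a = unskip-below a
... | _ | mid a b = unskip-between (≤-trans a (n≤1+n v)) b
... | _ | hi a b = unskip-above (≤-trans a (≤-trans (n≤1+n v) (n≤1+n (suc v)))) (≤-trans b (n≤1+n (suc v)))

skip∘unskip : ∀ {p q m} → p < q → m ≢ p → m ≢ q → skip p q (unskip p q m) ≡ m
skip∘unskip {p} {q} {m} pq m≢p m≢q with <-cmp m p
... | tri< a _ _ = trans (cong (skip p q) (unskip-below a)) (skip-below a)
... | tri≈ _ b _ = ⊥-elim (m≢p b)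
... | tri> _ _ p<m with <-cmp m q
...   | tri≈ _ b _ = ⊥-elim (m≢q b)
skip∘unskip {p} {q} {suc m′} pq m≢p m≢q | tri> _ _ p<m | tri< m<q _ _ =
  trans (cong (skip p q) (unskip-between (<⇒≤ p<m) m<q)) (skip-between (≤-pred p<m) m<q)
skip∘unskip {p} {q} {suc (suc m′)} pq m≢p m≢q | tri> _ _ p<m | tri> _ _ q<m =
  trans (cong (skip p q) (unskip-above (<⇒≤ p<m) (<⇒≤ q<m))) (skip-above (≤-pred (≤-trans pq (≤-pred q<m))) (≤-pred q<m))
skip∘unskip {p} {zero} {suc zero} () m≢p m≢q | tri> _ _ p<m | tri> _ _ q<m
skip∘unskip {p} {suc q} {suc zero} pq m≢p m≢q | tri> _ _ p<m | tri> _ _ (s≤s ())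


toℕ-punchIn-< : ∀ {n} (i : Fin (suc n)) (j : Fin n) → toℕ j < toℕ i → toℕ (punchIn i j) ≡ toℕ j
toℕ-punchIn-< zero j ()
toℕ-punchIn-< (suc i) zero h = refl
toℕ-punchIn-< (suc i) (suc j) (s≤s h) = cong suc (toℕ-punchIn-< i j h)

toℕ-punchIn-≥ : ∀ {n} (i : Fin (suc n)) (j : Fin n) → toℕ i ≤ toℕ j → toℕ (punchIn i j) ≡ suc (toℕ j)
toℕ-punchIn-≥ zero j h = refl
toℕ-punchIn-≥ (suc i) (suc j) (s≤s h) = cong suc (toℕ-punchIn-≥ i j h)

punchIn-mono-< : ∀ {n} (i : Fin (suc n)) {j k : Fin n} → toℕ j < toℕ k → toℕ (punchIn i j) < toℕ (punchIn i k)
punchIn-mono-< i {j} {k} j<k = ≤∧≢⇒< (FinP.punchIn-mono-≤ i j k (<⇒≤ j<k))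
  (λ e → <-irrefl (cong toℕ (FinP.punchIn-injective i j k (FinP.toℕ-injective e))) j<k)

punchIn-cancel-< : ∀ {n} (i : Fin (suc n)) {j k : Fin n} → toℕ (punchIn i j) < toℕ (punchIn i k) → toℕ j < toℕ k
punchIn-cancel-< i {j} {k} h = ≤∧≢⇒< (FinP.punchIn-cancel-≤ i j k (<⇒≤ h))
  (λ e → <-irrefl (cong (toℕ ∘ punchIn i) (FinP.toℕ-injective e)) h)

punchIn<i⇒j<i : ∀ {n} (i : Fin (suc n)) (j : Fin n) → toℕ (punchIn i j) < toℕ i → toℕ j < toℕ i
punchIn<i⇒j<i i j h with toℕ j <? toℕ i
... | yes x = x
... | no ¬x = ⊥-elim (<-irrefl refl (<-trans h (subst (toℕ i <_) (sym (toℕ-punchIn-≥ i j (≮⇒≥ ¬x))) (s≤s (≮⇒≥ ¬x)))))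

i<punchIn⇒i≤j : ∀ {n} (i : Fin (suc n)) (j : Fin n) → toℕ i < toℕ (punchIn i j) → toℕ i ≤ toℕ j
i<punchIn⇒i≤j i j h with toℕ j <? toℕ i
... | yes x = ⊥-elim (<-irrefl refl (<-trans h (subst (_< toℕ i) (sym (toℕ-punchIn-< i j x)) x)))
... | no ¬x = ≮⇒≥ ¬x

≡i⊎punchIn : ∀ {n} (i h : Fin (suc n)) → h ≡ i ⊎ ∃ λ j → h ≡ punchIn i j
≡i⊎punchIn i h with i FinP.≟ h
... | yes e = inj₁ (sym e)
... | no ne = inj₂ (punchOut ne , sym (FinP.punchIn-punchOut ne))

-- Each value in {1,…,m} has a preimage other than b; were f a ≡ f b for some a ≢ b, punching
-- b out of these preimages would inject Fin m into Fin (m ∸ 1).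
onto⇒injective : ∀ {m} (f : Fin m → ℕ) → (∀ v → 1 ≤ v → v ≤ m → ∃ λ s → f s ≡ v) →
                 ∀ a b → f a ≡ f b → a ≡ b
onto⇒injective f onto a b fa≡fb with a FinP.≟ b
... | yes a≡b = a≡b
... | no a≢b  = ⊥-elim (no-collision f onto a≢b fa≡fb)
  where
  no-collision : ∀ {m} (f : Fin m → ℕ) → (∀ v → 1 ≤ v → v ≤ m → ∃ λ s → f s ≡ v) →
                 ∀ {a b} → a ≢ b → f a ≡ f b → ⊥
  no-collision {suc m} f onto {a} {b} a≢b fa≡fb = pigeonhole-contradiction (FinP.pigeonhole (n<1+n m) g)
    where
    preimage : (y : Fin (suc m)) → Σ (Fin (suc m)) λ t → b ≢ t × f t ≡ suc (toℕ y)
    preimage y with onto (suc (toℕ y)) (s≤s z≤n) (FinP.toℕ<n y)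
    ... | t , ft≡y with t FinP.≟ b
    ...   | yes refl = a , a≢b ∘ sym , trans fa≡fb ft≡y
    ...   | no t≢b   = t , t≢b ∘ sym , ft≡y
    g : Fin (suc m) → Fin m
    g = punchOut ∘ proj₁ ∘ proj₂ ∘ preimage
    pigeonhole-contradiction : (∃ λ i → ∃ λ j → i Fin.< j × g i ≡ g j) → ⊥
    pigeonhole-contradiction (i , j , i<j , gi≡gj) = <-irrefl (suc-injective (begin
      suc (toℕ i)             ≡⟨ sym (proj₂ (proj₂ (preimage i))) ⟩
      f (proj₁ (preimage i))  ≡⟨ cong f (FinP.punchOut-injective (proj₁ (proj₂ (preimage i))) (proj₁ (proj₂ (preimage j))) gi≡gj) ⟩
      f (proj₁ (preimage j))  ≡⟨ proj₂ (proj₂ (preimage j)) ⟩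
      suc (toℕ j)             ∎)) i<j

lookup-extensional : ∀ {A : Set} {n} (xs ys : Vec A n) → (∀ i → lookup xs i ≡ lookup ys i) → xs ≡ ys
lookup-extensional xs ys e = trans (sym (VecP.tabulate∘lookup xs)) (trans (VecP.tabulate-cong e) (VecP.tabulate∘lookup ys))

lookup-removeAt : ∀ {A : Set} {n} (xs : Vec A (suc n)) (i : Fin (suc n)) (j : Fin n) →
                  lookup (removeAt xs i) j ≡ lookup xs (punchIn i j)
lookup-removeAt xs i j = trans (cong (lookup (removeAt xs i)) (sym (FinP.punchOut-punchIn i)))
                               (VecP.removeAt-punchOut xs (FinP.punchInᵢ≢i i j ∘ sym))

2*[1+n]≡2+2*n : ∀ n → 2 * suc n ≡ suc (suc (2 * n))
2*[1+n]≡2+2*n = solve-∀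

2*n≡n+n : ∀ n → 2 * n ≡ n + n
2*n≡n+n = solve-∀

lastL≡l-last : ∀ {n} (θ : Fam (suc n)) → lastL θ ≡ l θ (fromℕ n)
lastL≡l-last (x ∷ [])     = refl
lastL≡l-last (x ∷ y ∷ xs) = lastL≡l-last (y ∷ xs)

-- IsPP only asks the 2n endpoints to cover {1, …, 2n}, which forces them to be distinct.
module Endpoints {n} {θ : Fam n} (pp : IsPP n θ) where
  open IsPP pp

  endpoint : Fin n ⊎ Fin n → ℕ
  endpoint = [ l θ , r θ ]′

  endpoint-injective : ∀ x y → endpoint x ≡ endpoint y → x ≡ y
  endpoint-injective x y e = begin
    x                                 ≡⟨ sym (FinP.splitAt-join n n x) ⟩
    Fin.splitAt n (Fin.join n n x)    ≡⟨ cong (Fin.splitAt n) (onto⇒injective (endpoint ∘ Fin.splitAt n) onto _ _ e′) ⟩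
    Fin.splitAt n (Fin.join n n y)    ≡⟨ FinP.splitAt-join n n y ⟩
    y                                 ∎
    where
    e′ : endpoint (Fin.splitAt n (Fin.join n n x)) ≡ endpoint (Fin.splitAt n (Fin.join n n y))
    e′ = subst₂ (λ a b → endpoint a ≡ endpoint b) (sym (FinP.splitAt-join n n x)) (sym (FinP.splitAt-join n n y)) e
    onto : ∀ v → 1 ≤ v → v ≤ n + n → ∃ λ s → endpoint (Fin.splitAt n s) ≡ v
    onto v 1≤v v≤n+n with cover v 1≤v (subst (v ≤_) (sym (2*n≡n+n n)) v≤n+n)
    ... | h , inj₁ e = Fin.join n n (inj₁ h) , trans (cong endpoint (FinP.splitAt-join n n (inj₁ h))) e
    ... | h , inj₂ e = Fin.join n n (inj₂ h) , trans (cong endpoint (FinP.splitAt-join n n (inj₂ h))) e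

  l≢r : ∀ h k → l θ h ≢ r θ k
  l≢r h k e with endpoint-injective (inj₁ h) (inj₂ k) e
  ... | ()

  r-injective : ∀ h k → r θ h ≡ r θ k → h ≡ k
  r-injective h k e = ⊎.inj₂-injective (endpoint-injective (inj₂ h) (inj₂ k) e)

  l-injective : ∀ h k → l θ h ≡ l θ k → h ≡ k
  l-injective h k e with FinP.<-cmp h k
  ... | tri< h<k _ _ = ⊥-elim (<-irrefl e (l-incr h k h<k))
  ... | tri≈ _ h≡k _ = h≡k
  ... | tri> _ _ k<h = ⊥-elim (<-irrefl (sym e) (l-incr k h k<h))

skipPair : ℕ → ℕ → ℕ × ℕ → ℕ × ℕ
skipPair p q (x , y) = skip p q x , skip p q y

unskipPair : ℕ → ℕ → ℕ × ℕ → ℕ × ℕ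
unskipPair p q (x , y) = unskip p q x , unskip p q y

insertPair : ∀ {n} → ℕ → ℕ → Fin (suc n) → Fam n → Fam (suc n)
insertPair p q i θ = insertAt (Vec.map (skipPair p q) θ) i (p , q)

removePair : ∀ {n} → Fin (suc n) → Fam (suc n) → Fam n
removePair i θ = Vec.map (unskipPair (l θ i) (r θ i)) (removeAt θ i)

module _ {n} (p q : ℕ) (i : Fin (suc n)) (θ : Fam n) where

  l-insertPair-here : l (insertPair p q i θ) i ≡ p
  l-insertPair-here = cong proj₁ (VecP.insertAt-lookup _ i _)

  r-insertPair-here : r (insertPair p q i θ) i ≡ q
  r-insertPair-here = cong proj₂ (VecP.insertAt-lookup _ i _)

  insertPair-there : ∀ j → lookup (insertPair p q i θ) (punchIn i j) ≡ skipPair p q (lookup θ j)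
  insertPair-there j = trans (VecP.insertAt-punchIn _ i _ j) (VecP.lookup-map j _ θ)

  l-insertPair-there : ∀ j → l (insertPair p q i θ) (punchIn i j) ≡ skip p q (l θ j)
  l-insertPair-there j = cong proj₁ (insertPair-there j)

  r-insertPair-there : ∀ j → r (insertPair p q i θ) (punchIn i j) ≡ skip p q (r θ j)
  r-insertPair-there j = cong proj₂ (insertPair-there j)

removePair-insertPair : ∀ {n} p q (i : Fin (suc n)) θ → removePair i (insertPair p q i θ) ≡ θ
removePair-insertPair p q i θ = begin
  Vec.map (unskipPair (l θ′ i) (r θ′ i)) (removeAt θ′ i)
    ≡⟨ cong₂ (λ a b → Vec.map (unskipPair a b) (removeAt θ′ i)) (l-insertPair-here p q i θ) (r-insertPair-here p q i θ) ⟩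
  Vec.map (unskipPair p q) (removeAt θ′ i)
    ≡⟨ cong (Vec.map (unskipPair p q)) (VecP.removeAt-insertAt _ i _) ⟩
  Vec.map (unskipPair p q) (Vec.map (skipPair p q) θ)
    ≡⟨ map-unskip∘skip θ ⟩
  θ ∎
  where
  θ′ = insertPair p q i θ
  map-unskip∘skip : ∀ {n} (θ : Fam n) → Vec.map (unskipPair p q) (Vec.map (skipPair p q) θ) ≡ θ
  map-unskip∘skip []            = refl
  map-unskip∘skip ((x , y) ∷ θ) = cong₂ _∷_ (cong₂ _,_ (unskip∘skip {p} {q} {x}) (unskip∘skip {p} {q} {y})) (map-unskip∘skip θ)

insertPair-removePair : ∀ {n} (θ : Fam (suc n)) (i : Fin (suc n)) → IsPP (suc n) θ →
                        insertPair (l θ i) (r θ i) i (removePair i θ) ≡ θ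
insertPair-removePair θ i pp = trans (cong (λ θ′ → insertAt θ′ i (lookup θ i)) skip∘unskip-rest) (VecP.insertAt-removeAt θ i)
  where
  open IsPP pp
  open Endpoints pp
  p = l θ i
  q = r θ i
  i≢punchIn : ∀ j → i ≢ punchIn i j
  i≢punchIn j = FinP.punchInᵢ≢i i j ∘ sym
  skip∘unskip-rest : Vec.map (skipPair p q) (Vec.map (unskipPair p q) (removeAt θ i)) ≡ removeAt θ i
  skip∘unskip-rest = lookup-extensional _ _ λ j → begin
    lookup (Vec.map (skipPair p q) (Vec.map (unskipPair p q) (removeAt θ i))) j
      ≡⟨ VecP.lookup-map j (skipPair p q) (Vec.map (unskipPair p q) (removeAt θ i)) ⟩
    skipPair p q (lookup (Vec.map (unskipPair p q) (removeAt θ i)) j)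
      ≡⟨ cong (skipPair p q) (VecP.lookup-map j (unskipPair p q) (removeAt θ i)) ⟩
    skipPair p q (unskipPair p q (lookup (removeAt θ i) j))
      ≡⟨ cong (skipPair p q ∘ unskipPair p q) (lookup-removeAt θ i j) ⟩
    skipPair p q (unskipPair p q (lookup θ (punchIn i j)))
      ≡⟨ cong₂ _,_
           (skip∘unskip (l<r i) (i≢punchIn j ∘ l-injective i (punchIn i j) ∘ sym) (l≢r (punchIn i j) i))
           (skip∘unskip (l<r i) (l≢r i (punchIn i j) ∘ sym) (i≢punchIn j ∘ r-injective i (punchIn i j) ∘ sym)) ⟩
    lookup θ (punchIn i j)
      ≡⟨ sym (lookup-removeAt θ i j) ⟩
    lookup (removeAt θ i) j ∎

insertPair-cover : ∀ {n} (θ : Fam n) p q (i : Fin (suc n)) → IsPP n θ → 1 ≤ p → p < q → q ≤ 2 * suc n →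
                   ∀ m → 1 ≤ m → m ≤ 2 * suc n → ∃ λ h → l (insertPair p q i θ) h ≡ m ⊎ r (insertPair p q i θ) h ≡ m
insertPair-cover {n} θ p q i pp 1≤p pq q≤ m 1≤m m≤ with m ≟ p | m ≟ q
... | yes refl | _ = i , inj₁ (l-insertPair-here p q i θ)
... | no _ | yes refl = i , inj₂ (r-insertPair-here p q i θ)
... | no m≢p | no m≢q with IsPP.cover pp (unskip p q m) 1≤unskip unskip≤2n
  where
  skip∘unskip-m = skip∘unskip pq m≢p m≢q
  2+2n = 2*[1+n]≡2+2*n n
  1≤unskip : 1 ≤ unskip p q m
  1≤unskip = 1≤skip⇒1≤v {p} {q} 1≤p (subst (1 ≤_) (sym skip∘unskip-m) 1≤m)
  unskip≤2n : unskip p q m ≤ 2 * n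
  unskip≤2n = skip≤2+N⇒v≤N (2 * n) pq (subst (q ≤_) 2+2n q≤) (subst (_≤ suc (suc (2 * n))) (sym skip∘unskip-m) (subst (m ≤_) 2+2n m≤))
...   | j , inj₁ e = punchIn i j , inj₁ (trans (l-insertPair-there p q i θ j) (trans (cong (skip p q) e) (skip∘unskip pq m≢p m≢q)))
...   | j , inj₂ e = punchIn i j , inj₂ (trans (r-insertPair-there p q i θ j) (trans (cong (skip p q) e) (skip∘unskip pq m≢p m≢q)))

insertPair-IsPP : ∀ {n} (θ : Fam n) p q (i : Fin (suc n)) → IsPP n θ → 1 ≤ p → p < q → q ≤ 2 * suc n →
          (∀ j → toℕ j < toℕ i → l θ j < p) → (∀ j → toℕ i ≤ toℕ j → p ≤ l θ j) → IsPP (suc n) (insertPair p q i θ)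
insertPair-IsPP {n} θ p q i pp 1≤p pq q≤ below above = record
  { l-range = lrange ; r-range = rrange ; cover = insertPair-cover θ p q i pp 1≤p pq q≤ ; l<r = lr ; l-incr = linc }
  where
  open IsPP pp
  θ′ = insertPair p q i θ
  2+2n : 2 * suc n ≡ suc (suc (2 * n))
  2+2n = 2*[1+n]≡2+2*n n
  up : ∀ v → v ≤ 2 * n → skip p q v ≤ 2 * suc n
  up v h = subst (skip p q v ≤_) (sym 2+2n) (≤-trans (skip≤2+v {p} {q} {v}) (s≤s (s≤s h)))
  lrange : ∀ h → 1 ≤ l θ′ h × l θ′ h ≤ 2 * suc n
  lrange h with ≡i⊎punchIn i h
  ... | inj₁ refl = subst (λ z → 1 ≤ z × z ≤ 2 * suc n) (sym (l-insertPair-here p q i θ)) (1≤p , ≤-trans (<⇒≤ pq) q≤)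
  ... | inj₂ (j , refl) = subst (λ z → 1 ≤ z × z ≤ 2 * suc n) (sym (l-insertPair-there p q i θ j))
          (≤-trans (proj₁ (l-range j)) (v≤skip {p} {q}) , up _ (proj₂ (l-range j)))
  rrange : ∀ h → 1 ≤ r θ′ h × r θ′ h ≤ 2 * suc n
  rrange h with ≡i⊎punchIn i h
  ... | inj₁ refl = subst (λ z → 1 ≤ z × z ≤ 2 * suc n) (sym (r-insertPair-here p q i θ)) (≤-trans 1≤p (<⇒≤ pq) , q≤)
  ... | inj₂ (j , refl) = subst (λ z → 1 ≤ z × z ≤ 2 * suc n) (sym (r-insertPair-there p q i θ j))
          (≤-trans (proj₁ (r-range j)) (v≤skip {p} {q}) , up _ (proj₂ (r-range j)))
  lr : ∀ h → l θ′ h < r θ′ h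
  lr h with ≡i⊎punchIn i h
  ... | inj₁ refl = subst₂ _<_ (sym (l-insertPair-here p q i θ)) (sym (r-insertPair-here p q i θ)) pq
  ... | inj₂ (j , refl) = subst₂ _<_ (sym (l-insertPair-there p q i θ j)) (sym (r-insertPair-there p q i θ j)) (skip-mono-< {p} {q} (l<r j))
  linc : ∀ h k → h Fin.< k → l θ′ h < l θ′ k
  linc h k h<k with ≡i⊎punchIn i h | ≡i⊎punchIn i k
  ... | inj₁ refl | inj₁ refl = ⊥-elim (<-irrefl refl h<k)
  ... | inj₁ refl | inj₂ (j , refl) = subst₂ _<_ (sym (l-insertPair-here p q i θ)) (sym (l-insertPair-there p q i θ j)) (p≤v⇒p<skip (above j (i<punchIn⇒i≤j i j h<k)))
  ... | inj₂ (j , refl) | inj₁ refl = subst₂ _<_ (sym (l-insertPair-there p q i θ j)) (sym (l-insertPair-here p q i θ))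
          (subst (_< p) (sym (skip-below (below j (punchIn<i⇒j<i i j h<k)))) (below j (punchIn<i⇒j<i i j h<k)))
  ... | inj₂ (j , refl) | inj₂ (j′ , refl) = subst₂ _<_ (sym (l-insertPair-there p q i θ j)) (sym (l-insertPair-there p q i θ j′))
          (skip-mono-< {p} {q} (l-incr j j′ (punchIn-cancel-< i h<k)))

insertPair-IsPP⁻ : ∀ {n} (θ : Fam n) p q (i : Fin (suc n)) → IsPP (suc n) (insertPair p q i θ) → IsPP n θ
insertPair-IsPP⁻ {n} θ p q i pp′ = record
  { l-range = lrange ; r-range = rrange ; cover = cov ; l<r = lr ; l-incr = linc }
  where
  open IsPP pp′ renaming (l-range to l-range′; r-range to r-range′; cover to cover′; l<r to l<r′; l-incr to l-incr′)
  θ′ = insertPair p q i θ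
  2+2n : 2 * suc n ≡ suc (suc (2 * n))
  2+2n = 2*[1+n]≡2+2*n n
  1≤p : 1 ≤ p
  1≤p = subst (1 ≤_) (l-insertPair-here p q i θ) (proj₁ (l-range′ i))
  pq : p < q
  pq = subst₂ _<_ (l-insertPair-here p q i θ) (r-insertPair-here p q i θ) (l<r′ i)
  q≤ : q ≤ suc (suc (2 * n))
  q≤ = subst₂ _≤_ (r-insertPair-here p q i θ) 2+2n (proj₂ (r-range′ i))
  refl-range : ∀ v → 1 ≤ skip p q v × skip p q v ≤ 2 * suc n → 1 ≤ v × v ≤ 2 * n
  refl-range v (a , b) = 1≤skip⇒1≤v {p} {q} 1≤p a , skip≤2+N⇒v≤N (2 * n) pq q≤ (subst (skip p q v ≤_) 2+2n b)
  lrange : ∀ j → 1 ≤ l θ j × l θ j ≤ 2 * n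
  lrange j = refl-range _ (subst (λ z → 1 ≤ z × z ≤ 2 * suc n) (l-insertPair-there p q i θ j) (l-range′ (punchIn i j)))
  rrange : ∀ j → 1 ≤ r θ j × r θ j ≤ 2 * n
  rrange j = refl-range _ (subst (λ z → 1 ≤ z × z ≤ 2 * suc n) (r-insertPair-there p q i θ j) (r-range′ (punchIn i j)))
  cov : ∀ m → 1 ≤ m → m ≤ 2 * n → ∃ λ j → l θ j ≡ m ⊎ r θ j ≡ m
  cov m 1≤m m≤ with cover′ (skip p q m) (≤-trans 1≤m (v≤skip {p} {q})) (subst (skip p q m ≤_) (sym 2+2n) (≤-trans (skip≤2+v {p} {q} {m}) (s≤s (s≤s m≤))))
  ... | h , inj₁ e with ≡i⊎punchIn i h
  ...   | inj₁ refl = ⊥-elim (skip≢p (sym (trans (sym (l-insertPair-here p q i θ)) e)))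
  ...   | inj₂ (j , refl) = j , inj₁ (skip-injective {p} {q} (trans (sym (l-insertPair-there p q i θ j)) e))
  cov m 1≤m m≤ | h , inj₂ e with ≡i⊎punchIn i h
  ...   | inj₁ refl = ⊥-elim (skip≢q pq (sym (trans (sym (r-insertPair-here p q i θ)) e)))
  ...   | inj₂ (j , refl) = j , inj₂ (skip-injective {p} {q} (trans (sym (r-insertPair-there p q i θ j)) e))
  lr : ∀ j → l θ j < r θ j
  lr j = skip-cancel-< {p} {q} (subst₂ _<_ (l-insertPair-there p q i θ j) (r-insertPair-there p q i θ j) (l<r′ (punchIn i j)))
  linc : ∀ j k → j Fin.< k → l θ j < l θ k
  linc j k j<k = skip-cancel-< {p} {q} (subst₂ _<_ (l-insertPair-there p q i θ j) (l-insertPair-there p q i θ k) (l-incr′ _ _ (punchIn-mono-< i j<k)))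

skip-<⇔ : ∀ {p q v w} → (v < w) ⇔ (skip p q v < skip p q w)
skip-<⇔ {p} {q} = mk⇔ (skip-mono-< {p} {q}) (skip-cancel-< {p} {q})

<⇔<-subst : ∀ {a a′ b b′ c c′ d d′} → a ≡ a′ → b ≡ b′ → c ≡ c′ → d ≡ d′ →
            (a < b) ⇔ (c < d) → (a′ < b′) ⇔ (c′ < d′)
<⇔<-subst refl refl refl refl a<b⇔c<d = a<b⇔c<d

insertPair-NonCrossing⁻ : ∀ {n} (θ : Fam n) p q (i : Fin (suc n)) → NonCrossing (insertPair p q i θ) → NonCrossing θ
insertPair-NonCrossing⁻ θ p q i nc j k j<k =
  ⇔.trans (skip-<⇔ {p} {q})
    (⇔.trans (<⇔<-subst (l-insertPair-there p q i θ k) (r-insertPair-there p q i θ j)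
                        (r-insertPair-there p q i θ k) (r-insertPair-there p q i θ j)
                        (nc (punchIn i j) (punchIn i k) (punchIn-mono-< i j<k)))
             (⇔.sym (skip-<⇔ {p} {q})))

m∸n≡k⇒n+k≡m : ∀ {m n k} → n ≤ m → m ∸ n ≡ k → n + k ≡ m
m∸n≡k⇒n+k≡m {n = n} n≤m refl = m+[n∸m]≡n n≤m

n+k≡m⇒m∸n≡k : ∀ {m n k} → n + k ≡ m → m ∸ n ≡ k
n+k≡m⇒m∸n≡k {n = n} {k} refl = m+n∸m≡n n k

module _ {n} (g : Fin n → ℕ) where

  private
    step-back : ∀ {d} (h k : Fin n) → toℕ k ≡ toℕ h + suc d → Σ (Fin n) λ k′ → toℕ k′ ≡ toℕ h + d × toℕ k′ < toℕ k
    step-back {d} h k k≡h+1+d = fromℕ< h+d<n , FinP.toℕ-fromℕ< h+d<n ,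
                                  subst₂ _<_ (sym (FinP.toℕ-fromℕ< h+d<n)) (sym k≡1+h+d) (n<1+n _)
      where
      k≡1+h+d = trans k≡h+1+d (+-suc (toℕ h) d)
      h+d<n : toℕ h + d < n
      h+d<n = <-trans (subst (toℕ h + d <_) (sym k≡1+h+d) (n<1+n _)) (FinP.toℕ<n k)

  increasing⇒spread : (∀ h k → toℕ h < toℕ k → g h < g k) → ∀ d h k → toℕ k ≡ toℕ h + d → g h + d ≤ g k
  increasing⇒spread inc zero    h k k≡h+0 = ≤-reflexive (trans (+-identityʳ (g h))
                                            (cong g (FinP.toℕ-injective (sym (trans k≡h+0 (+-identityʳ (toℕ h)))))))
  increasing⇒spread inc (suc d) h k k≡h+1+d =
    let k′ , k′≡h+d , k′<k = step-back h k k≡h+1+d in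
    subst (_≤ g k) (sym (+-suc (g h) d)) (≤-<-trans (increasing⇒spread inc d h k′ k′≡h+d) (inc k′ k k′<k))

  decreasing⇒spread : (∀ h k → toℕ h < toℕ k → g k < g h) → ∀ d h k → toℕ k ≡ toℕ h + d → g k + d ≤ g h
  decreasing⇒spread dec zero    h k k≡h+0 = ≤-reflexive (trans (+-identityʳ (g k))
                                            (cong g (FinP.toℕ-injective (trans k≡h+0 (+-identityʳ (toℕ h))))))
  decreasing⇒spread dec (suc d) h k k≡h+1+d =
    let k′ , k′≡h+d , k′<k = step-back h k k≡h+1+d in
    subst (_≤ g h) (sym (+-suc (g k) d)) (≤-trans (+-monoˡ-≤ d (dec k′ k k′<k)) (decreasing⇒spread dec d h k′ k′≡h+d))

l-spread : ∀ {n} {θ : Fam n} → IsPP n θ → ∀ h k → toℕ h ≤ toℕ k → l θ h + (toℕ k ∸ toℕ h) ≤ l θ k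
l-spread {θ = θ} pp h k h≤k = increasing⇒spread (l θ) (IsPP.l-incr pp) (toℕ k ∸ toℕ h) h k (sym (m+[n∸m]≡n h≤k))

l≤lastL : ∀ {n} {θ : Fam n} → IsPP n θ → ∀ j → l θ j ≤ lastL θ
l≤lastL {suc m} {θ} pp j = subst (l θ j ≤_) (sym (lastL≡l-last θ))
  (m+n≤o⇒m≤o (l θ j) (l-spread pp j (fromℕ m) (subst (toℕ j ≤_) (sym (FinP.toℕ-fromℕ m)) (≤-pred (FinP.toℕ<n j)))))

module _ {m} {θ : Fam (suc m)} (pp : IsPP (suc m) θ) where
  open IsPP pp

  lastL<2*[1+m] : lastL θ < 2 * suc m
  lastL<2*[1+m] = subst (_< 2 * suc m) (sym (lastL≡l-last θ)) (<-≤-trans (l<r (fromℕ m)) (proj₂ (r-range (fromℕ m))))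

  l-first≡1 : l θ zero ≡ 1
  l-first≡1 with cover 1 ≤-refl (subst (1 ≤_) (sym (2*[1+n]≡2+2*n m)) (s≤s z≤n))
  ... | h , inj₁ e = ≤-antisym (subst (l θ zero ≤_) e (m+n≤o⇒m≤o (l θ zero) (l-spread pp zero h z≤n))) (proj₁ (l-range zero))
  ... | h , inj₂ e = ⊥-elim (<-irrefl refl (<-≤-trans (subst (l θ h <_) e (l<r h)) (proj₁ (l-range h))))

lastL≤2n : ∀ {n} {θ : Fam n} → IsPP n θ → lastL θ ≤ 2 * n
lastL≤2n {zero}  {[]} pp = z≤n
lastL≤2n {suc m}      pp = <⇒≤ (lastL<2*[1+m] pp)

n≤lastL : ∀ {n} {θ : Fam n} → IsPP n θ → n ≤ lastL θ
n≤lastL {zero}           pp = z≤n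
n≤lastL {suc m} {θ = θ} pp = subst (suc m ≤_) (sym (lastL≡l-last θ))
  (≤-trans (+-mono-≤ (proj₁ (IsPP.l-range pp zero)) (≤-reflexive (sym (FinP.toℕ-fromℕ m)))) (l-spread pp zero (fromℕ m) z≤n))

2n∸lastL≤n : ∀ {n} {θ : Fam n} → IsPP n θ → 2 * n ∸ lastL θ ≤ n
2n∸lastL≤n {n} pp = ≤-trans (∸-monoʳ-≤ (2 * n) (n≤lastL pp)) (≤-reflexive (n+k≡m⇒m∸n≡k (sym (2*n≡n+n n))))

lastL-insertPair-first : ∀ {m} p q (θ : Fam (suc m)) → lastL (insertPair p q zero θ) ≡ skip p q (lastL θ)
lastL-insertPair-first {m} p q θ = begin
  lastL (insertPair p q zero θ)                 ≡⟨ lastL≡l-last (insertPair p q zero θ) ⟩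
  l (insertPair p q zero θ) (suc (fromℕ m))     ≡⟨ l-insertPair-there p q zero θ (fromℕ m) ⟩
  skip p q (l θ (fromℕ m))                      ≡⟨ cong (skip p q) (sym (lastL≡l-last θ)) ⟩
  skip p q (lastL θ)                            ∎

IsNCPP-[] : IsNCPP 0 []
IsNCPP-[] = record { l-range = λ () ; r-range = λ () ; cover = λ { zero () _ ; (suc m) _ () } ; l<r = λ () ; l-incr = λ () }
          , λ ()

-- Removing the first pair

r-insertPair-first : ∀ {m} {P : Fam m → Set} {q θ} → Image (insertPair 1 q zero) P θ → r θ zero ≡ q
r-insertPair-first {q = q} (θ′ , _ , refl) = r-insertPair-here 1 q zero θ′

HasSize-byFirstPair : ∀ {m} {P : Fam m → Set} {Q : Fam (suc m) → Set} a b s →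
  (∀ θ → Q θ ⇔ (∃ λ q → a ≤ q × q ≤ b × Image (insertPair 1 q zero) P θ)) →
  HasSize P s → HasSize Q (sumFromTo a b (λ _ → s))
HasSize-byFirstPair {P = P} a b s Q⇔ size =
  HasSize-cong (⇔.sym ∘ Q⇔)
    (HasSize-⋃ (λ q → Image (insertPair 1 q zero) P) (λ _ → s)
               (λ q → HasSize-image (insertPair 1 q zero) (removePair zero) (removePair-insertPair 1 q zero) size)
               (λ q q′ θ x y → trans (sym (r-insertPair-first x)) (r-insertPair-first y)) a b)

IsPP⇔firstPair : ∀ m θ → IsPP (suc m) θ ⇔ (∃ λ q → 2 ≤ q × q ≤ 2 * suc m × Image (insertPair 1 q zero) (IsPP m) θ)
IsPP⇔firstPair m θ = mk⇔ split join
  where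
  split : IsPP (suc m) θ → ∃ λ q → 2 ≤ q × q ≤ 2 * suc m × Image (insertPair 1 q zero) (IsPP m) θ
  split pp = r θ zero , subst (_< r θ zero) (l-first≡1 pp) (l<r zero) , proj₂ (r-range zero) ,
             removePair zero θ , insertPair-IsPP⁻ (removePair zero θ) 1 (r θ zero) zero (subst (IsPP (suc m)) θ≡ pp) , θ≡
    where
    open IsPP pp
    θ≡ : θ ≡ insertPair 1 (r θ zero) zero (removePair zero θ)
    θ≡ = sym (trans (cong (λ p → insertPair p (r θ zero) zero (removePair zero θ)) (sym (l-first≡1 pp)))
                    (insertPair-removePair θ zero pp))
  join : (∃ λ q → 2 ≤ q × q ≤ 2 * suc m × Image (insertPair 1 q zero) (IsPP m) θ) → IsPP (suc m) θ
  join (q , 2≤q , q≤ , θ′ , pp′ , refl) =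
    insertPair-IsPP θ′ 1 q zero pp′ ≤-refl 2≤q q≤ (λ j ()) (λ j _ → proj₁ (IsPP.l-range pp′ j))

HasSize-IsPP : ∀ m → HasSize (IsPP m) (oddFact m)
HasSize-IsPP zero    = HasSize-singleton [] λ { [] → mk⇔ (λ _ → refl) (λ _ → proj₁ IsNCPP-[]) }
HasSize-IsPP (suc m) = subst (HasSize (IsPP (suc m))) count
  (HasSize-byFirstPair 2 (2 * suc m) (oddFact m) (IsPP⇔firstPair m) (HasSize-IsPP m))
  where
  count : sumFromTo 2 (2 * suc m) (λ _ → oddFact m) ≡ oddFact (suc m)
  count = begin
    sumCount 2 (suc (2 * suc m) ∸ 2) (λ _ → oddFact m) ≡⟨ cong (λ x → sumCount 2 (suc x ∸ 2) (λ _ → oddFact m)) (2*[1+n]≡2+2*n m) ⟩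
    sumCount 2 (suc (2 * m)) (λ _ → oddFact m)          ≡⟨ sumCount-const 2 (suc (2 * m)) (oddFact m) ⟩
    suc (2 * m) * oddFact m                             ≡⟨ cong (_* oddFact m) (+-comm 1 (2 * m)) ⟩
    oddFact (suc m)                                     ∎

2n∸lastL≡n⇒lastL≡n : ∀ {n} {θ : Fam n} → IsPP n θ → 2 * n ∸ lastL θ ≡ n → lastL θ ≡ n
2n∸lastL≡n⇒lastL≡n {n} {θ} pp e = +-cancelʳ-≡ n (lastL θ) n (trans (m∸n≡k⇒n+k≡m (lastL≤2n pp) e) (2*n≡n+n n))

lastL≡n⇒2n∸lastL≡n : ∀ {n} {θ : Fam n} → lastL θ ≡ n → 2 * n ∸ lastL θ ≡ n
lastL≡n⇒2n∸lastL≡n {n} e = n+k≡m⇒m∸n≡k (trans (cong (_+ n) e) (sym (2*n≡n+n n)))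

module _ {m} {θ : Fam (suc m)} (pp : IsPP (suc m) θ) (lastL≡1+m : lastL θ ≡ suc m) where
  open IsPP pp

  l≡1+index : ∀ h → l θ h ≡ suc (toℕ h)
  l≡1+index h = ≤-antisym upper lower
    where
    t = toℕ h
    t≤m : t ≤ m
    t≤m = ≤-pred (FinP.toℕ<n h)
    lower : suc t ≤ l θ h
    lower = subst (λ x → x + t ≤ l θ h) (l-first≡1 pp) (l-spread pp zero h z≤n)
    upper : l θ h ≤ suc t
    upper = +-cancelʳ-≤ (m ∸ t) (l θ h) (suc t)
      (subst₂ (λ a b → l θ h + (a ∸ t) ≤ b) (FinP.toℕ-fromℕ m) l-last≡1+t+[m∸t]
              (l-spread pp h (fromℕ m) (subst (t ≤_) (sym (FinP.toℕ-fromℕ m)) t≤m)))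
      where
      l-last≡1+t+[m∸t] : l θ (fromℕ m) ≡ suc t + (m ∸ t)
      l-last≡1+t+[m∸t] = trans (sym (lastL≡l-last θ)) (trans lastL≡1+m (cong suc (sym (m+[n∸m]≡n t≤m))))

  1+m<r : ∀ h → suc m < r θ h
  1+m<r h with suc m <? r θ h
  ... | yes 1+m<r = 1+m<r
  ... | no  1+m≮r = ⊥-elim (Endpoints.l≢r pp h′ h l≡r)
    where
    1≤r : 1 ≤ r θ h
    1≤r = ≤-trans (proj₁ (l-range h)) (<⇒≤ (l<r h))
    r∸1<1+m : r θ h ∸ 1 < suc m
    r∸1<1+m = <-≤-trans (∸-monoʳ-< (s≤s z≤n) 1≤r) (≮⇒≥ 1+m≮r)
    h′ = fromℕ< r∸1<1+m
    l≡r : l θ h′ ≡ r θ h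
    l≡r = trans (l≡1+index h′) (trans (cong suc (FinP.toℕ-fromℕ< r∸1<1+m)) (trans (+-comm 1 _) (m∸n+n≡m 1≤r)))

lastL-insertPair-first⇔ : ∀ {m} q (θ′ : Fam m) → suc (suc m) ≤ q → lastL (insertPair 1 q zero θ′) ≡ suc m ⇔ lastL θ′ ≡ m
lastL-insertPair-first⇔ {zero}  q [] _     = mk⇔ (λ _ → refl) (λ _ → refl)
lastL-insertPair-first⇔ {suc m} q θ′ 3+m≤q = mk⇔
  (λ e → skip-injective {1} {q} (trans (sym (lastL-insertPair-first 1 q θ′)) (trans e (sym skip-1+m))))
  (λ e → trans (lastL-insertPair-first 1 q θ′) (trans (cong (skip 1 q) e) skip-1+m))
  where
  skip-1+m : skip 1 q (suc m) ≡ suc (suc m)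
  skip-1+m = skip-between (s≤s z≤n) 3+m≤q

IsPPk-n⇔firstPair : ∀ m θ → IsPPk (suc m) (suc m) θ ⇔
  (∃ λ q → suc (suc m) ≤ q × q ≤ 2 * suc m × Image (insertPair 1 q zero) (IsPPk m m) θ)
IsPPk-n⇔firstPair m θ = mk⇔ split join
  where
  split : IsPPk (suc m) (suc m) θ → ∃ λ q → suc (suc m) ≤ q × q ≤ 2 * suc m × Image (insertPair 1 q zero) (IsPPk m m) θ
  split (pp , e) = refine (to (IsPP⇔firstPair m θ) pp)
    where
    lastL≡1+m : lastL θ ≡ suc m
    lastL≡1+m = 2n∸lastL≡n⇒lastL≡n pp e
    refine : (∃ λ q → 2 ≤ q × q ≤ 2 * suc m × Image (insertPair 1 q zero) (IsPP m) θ) →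
             ∃ λ q → suc (suc m) ≤ q × q ≤ 2 * suc m × Image (insertPair 1 q zero) (IsPPk m m) θ
    refine (q , _ , q≤ , θ′ , pp′ , θ≡) = q , 2+m≤q , q≤ , θ′ , (pp′ , lastL≡n⇒2n∸lastL≡n {θ = θ′} lastL≡m) , θ≡
      where
      2+m≤q : suc (suc m) ≤ q
      2+m≤q = subst (suc m <_) (r-insertPair-first {P = IsPP m} (θ′ , pp′ , θ≡)) (1+m<r pp lastL≡1+m zero)
      lastL≡m : lastL θ′ ≡ m
      lastL≡m = to (lastL-insertPair-first⇔ q θ′ 2+m≤q) (trans (cong lastL (sym θ≡)) lastL≡1+m)
  join : (∃ λ q → suc (suc m) ≤ q × q ≤ 2 * suc m × Image (insertPair 1 q zero) (IsPPk m m) θ) → IsPPk (suc m) (suc m) θ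
  join (q , 2+m≤q , q≤ , θ′ , (pp′ , e′) , refl) =
    from (IsPP⇔firstPair m _) (q , ≤-trans (s≤s (s≤s z≤n)) 2+m≤q , q≤ , θ′ , pp′ , refl) ,
    lastL≡n⇒2n∸lastL≡n {θ = insertPair 1 q zero θ′} (from (lastL-insertPair-first⇔ q θ′ 2+m≤q) (2n∸lastL≡n⇒lastL≡n pp′ e′))

HasSize-IsPPk-n : ∀ m → HasSize (IsPPk m m) (m !)
HasSize-IsPPk-n zero    = HasSize-singleton [] λ { [] → mk⇔ (λ _ → refl) (λ _ → proj₁ IsNCPP-[] , refl) }
HasSize-IsPPk-n (suc m) = subst (HasSize (IsPPk (suc m) (suc m))) count
  (HasSize-byFirstPair (suc (suc m)) (2 * suc m) (m !) (IsPPk-n⇔firstPair m) (HasSize-IsPPk-n m))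
  where
  count : sumFromTo (suc (suc m)) (2 * suc m) (λ _ → m !) ≡ suc m !
  count = begin
    sumCount (suc (suc m)) (suc (2 * suc m) ∸ suc (suc m)) (λ _ → m !)
      ≡⟨ cong (λ x → sumCount (suc (suc m)) (x ∸ suc m) (λ _ → m !)) (2*n≡n+n (suc m)) ⟩
    sumCount (suc (suc m)) (suc m + suc m ∸ suc m) (λ _ → m !)
      ≡⟨ cong (λ x → sumCount (suc (suc m)) x (λ _ → m !)) (m+n∸m≡n (suc m) (suc m)) ⟩
    sumCount (suc (suc m)) (suc m) (λ _ → m !)
      ≡⟨ sumCount-const _ (suc m) (m !) ⟩
    suc m !  ∎

-- Removing the last pair

addLast : ∀ {n} → ℕ → Fam n → Fam (suc n)
addLast {n} p = insertPair p (suc p) (fromℕ n)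

removeLast : ∀ {n} → Fam (suc n) → Fam n
removeLast {n} = removePair (fromℕ n)

removeLast-addLast : ∀ {n} p (θ : Fam n) → removeLast (addLast p θ) ≡ θ
removeLast-addLast {n} p = removePair-insertPair p (suc p) (fromℕ n)

lastL-addLast : ∀ {n} p (θ : Fam n) → lastL (addLast p θ) ≡ p
lastL-addLast {n} p θ = trans (lastL≡l-last (addLast p θ)) (l-insertPair-here p (suc p) (fromℕ n) θ)

addLast-removeLast : ∀ {n} {θ : Fam (suc n)} {p} → IsPP (suc n) θ →
                     l θ (fromℕ n) ≡ p → r θ (fromℕ n) ≡ suc p → θ ≡ addLast p (removeLast θ)
addLast-removeLast {n} {θ} pp refl r≡ =
  sym (trans (cong (λ q → insertPair (l θ (fromℕ n)) q (fromℕ n) (removeLast θ)) (sym r≡)) (insertPair-removePair θ (fromℕ n) pp))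

addLast-NonCrossing : ∀ {n} (θ : Fam n) p → NonCrossing θ → NonCrossing (addLast p θ)
addLast-NonCrossing {n} θ p nc h k h<k with ≡i⊎punchIn (fromℕ n) h | ≡i⊎punchIn (fromℕ n) k
... | inj₁ refl | _ = ⊥-elim (<-irrefl refl (<-≤-trans h<k (subst (toℕ k ≤_) (sym (FinP.toℕ-fromℕ n)) (≤-pred (FinP.toℕ<n k)))))
... | inj₂ (j , refl) | inj₁ refl =
  <⇔<-subst (sym (l-insertPair-here p (suc p) (fromℕ n) θ)) (sym (r-insertPair-there p (suc p) (fromℕ n) θ j))
            (sym (r-insertPair-here p (suc p) (fromℕ n) θ)) (sym (r-insertPair-there p (suc p) (fromℕ n) θ j))
            (mk⇔ (λ p<r → ≤∧≢⇒< p<r (skip≢q {p} {suc p} (n<1+n p) ∘ sym)) (<-trans (n<1+n p)))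
... | inj₂ (j , refl) | inj₂ (j′ , refl) =
  <⇔<-subst (sym (l-insertPair-there p (suc p) (fromℕ n) θ j′)) (sym (r-insertPair-there p (suc p) (fromℕ n) θ j))
            (sym (r-insertPair-there p (suc p) (fromℕ n) θ j′)) (sym (r-insertPair-there p (suc p) (fromℕ n) θ j))
            (⇔.trans (⇔.sym (skip-<⇔ {p} {suc p})) (⇔.trans (nc j j′ (punchIn-cancel-< (fromℕ n) h<k)) (skip-<⇔ {p} {suc p})))

toℕ-punchIn-last : ∀ {n} (j : Fin n) → toℕ (punchIn (fromℕ n) j) ≡ toℕ j
toℕ-punchIn-last {n} j = toℕ-punchIn-< (fromℕ n) j (subst (toℕ j <_) (sym (FinP.toℕ-fromℕ n)) (FinP.toℕ<n j))

addLast-IsPP : ∀ {n} (θ : Fam n) p → IsPP n θ → 1 ≤ p → p ≤ suc (2 * n) → (∀ j → l θ j < p) → IsPP (suc n) (addLast p θ)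
addLast-IsPP {n} θ p pp 1≤p p≤1+2n l<p =
  insertPair-IsPP θ p (suc p) (fromℕ n) pp 1≤p (n<1+n p) (subst (suc p ≤_) (sym (2*[1+n]≡2+2*n n)) (s≤s p≤1+2n))
    (λ j _ → l<p j) (λ j n≤j → ⊥-elim (<-irrefl refl (<-≤-trans (FinP.toℕ<n j) (subst (_≤ toℕ j) (FinP.toℕ-fromℕ n) n≤j))))

module _ {n} {θ : Fam n} {p} (pp : IsPP (suc n) (addLast p θ)) where

  addLast-IsPP⁻ : IsPP n θ
  addLast-IsPP⁻ = insertPair-IsPP⁻ θ p (suc p) (fromℕ n) pp

  addLast⇒l< : ∀ j → l θ j < p
  addLast⇒l< j = skip<p⇒v<p {p} {suc p} (subst₂ _<_ (l-insertPair-there p (suc p) (fromℕ n) θ j) (l-insertPair-here p (suc p) (fromℕ n) θ)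
    (IsPP.l-incr pp (punchIn (fromℕ n) j) (fromℕ n) (subst₂ _<_ (sym (toℕ-punchIn-last j)) (sym (FinP.toℕ-fromℕ n)) (FinP.toℕ<n j))))

addLast⇒lastL< : ∀ {n} {θ : Fam n} {p} → IsPP (suc n) (addLast p θ) → lastL θ < p
addLast⇒lastL< {zero}  {[]} {p} pp = subst (1 ≤_) (lastL-addLast p []) (n≤lastL pp)
addLast⇒lastL< {suc m} {θ}  {p} pp = subst (_< p) (sym (lastL≡l-last θ)) (addLast⇒l< pp (fromℕ m))

IsPPk-1⇔addLast : ∀ m θ → IsPPk (suc m) 1 θ ⇔ Image (addLast (suc (2 * m))) (IsPP m) θ
IsPPk-1⇔addLast m θ = mk⇔ split join
  where
  2+2m∸[1+2m]≡1 : suc (suc (2 * m)) ∸ suc (2 * m) ≡ 1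
  2+2m∸[1+2m]≡1 = n+k≡m⇒m∸n≡k {n = suc (2 * m)} (+-comm (suc (2 * m)) 1)
  split : IsPPk (suc m) 1 θ → Image (addLast (suc (2 * m))) (IsPP m) θ
  split (pp , e) = removeLast θ , addLast-IsPP⁻ (subst (IsPP (suc m)) θ≡ pp) , θ≡
    where
    open IsPP pp
    l-last≡1+2m : l θ (fromℕ m) ≡ suc (2 * m)
    l-last≡1+2m = trans (sym (lastL≡l-last θ))
      (suc-injective (trans (+-comm 1 _) (trans (m∸n≡k⇒n+k≡m (lastL≤2n pp) e) (2*[1+n]≡2+2*n m))))
    r-last≡2+2m : r θ (fromℕ m) ≡ suc (suc (2 * m))
    r-last≡2+2m = ≤-antisym (subst (r θ (fromℕ m) ≤_) (2*[1+n]≡2+2*n m) (proj₂ (r-range (fromℕ m))))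
                            (subst (_< r θ (fromℕ m)) l-last≡1+2m (l<r (fromℕ m)))
    θ≡ = addLast-removeLast pp l-last≡1+2m r-last≡2+2m
  join : Image (addLast (suc (2 * m))) (IsPP m) θ → IsPPk (suc m) 1 θ
  join (θ′ , pp′ , refl) =
    addLast-IsPP θ′ (suc (2 * m)) pp′ (s≤s z≤n) ≤-refl (λ j → s≤s (proj₂ (IsPP.l-range pp′ j))) ,
    trans (cong (2 * suc m ∸_) (lastL-addLast _ θ′)) (trans (cong (_∸ suc (2 * m)) (2*[1+n]≡2+2*n m)) 2+2m∸[1+2m]≡1)

HasSize-IsPPk-1 : ∀ m → HasSize (IsPPk (suc m) 1) (oddFact m)
HasSize-IsPPk-1 m = HasSize-cong (⇔.sym ∘ IsPPk-1⇔addLast m)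
  (HasSize-image (addLast (suc (2 * m))) removeLast (removeLast-addLast _) (HasSize-IsPP m))

IsNCPPk≥ : (n k : ℕ) → Fam n → Set
IsNCPPk≥ n k θ = ∃ λ h → k ≤ h × h ≤ n × IsNCPPk n h θ

-- In NCPP_{k+1}(2n+2) the last left endpoint is 2n+1−k, and its partner must be the next point:
-- a pair closing at 2n+2−k would have to open before it and so would enclose the last pair.
IsNCPPk⇒≡addLast : ∀ n k θ → IsNCPPk (suc n) (suc k) θ → θ ≡ addLast (suc (2 * n) ∸ k) (removeLast θ)
IsNCPPk⇒≡addLast n k θ ((pp , nc) , e) = addLast-removeLast pp l-last≡p r-last≡1+p
  where
  open IsPP pp
  p = suc (2 * n) ∸ k
  last = fromℕ n
  lastL+k≡1+2n : lastL θ + k ≡ suc (2 * n)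
  lastL+k≡1+2n = suc-injective (trans (sym (+-suc (lastL θ) k)) (trans (m∸n≡k⇒n+k≡m (lastL≤2n pp) e) (2*[1+n]≡2+2*n n)))
  l-last≡p : l θ last ≡ p
  l-last≡p = trans (sym (lastL≡l-last θ)) (sym (trans (cong (_∸ k) (sym lastL+k≡1+2n)) (m+n∸n≡m (lastL θ) k)))
  p<r-last : p < r θ last
  p<r-last = subst (_< r θ last) l-last≡p (l<r last)
  r-last≡1+p : r θ last ≡ suc p
  r-last≡1+p with cover (suc p) (s≤s z≤n) (≤-trans p<r-last (proj₂ (r-range last)))
  ... | h , inj₁ l≡1+p = ⊥-elim (<-irrefl refl (<-≤-trans (n<1+n p)
                           (subst (_≤ p) l≡1+p (subst (l θ h ≤_) (trans (lastL≡l-last θ) l-last≡p) (l≤lastL pp h)))))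
  ... | h , inj₂ r≡1+p with ≡i⊎punchIn last h
  ...   | inj₁ refl       = r≡1+p
  ...   | inj₂ (j , refl) = ⊥-elim (<-irrefl refl (<-≤-trans p<r-last (≤-pred (subst (r θ last <_) r≡1+p (to (nc _ last h<last) l-last<r)))))
    where
    h<last : toℕ (punchIn last j) < toℕ last
    h<last = subst₂ _<_ (sym (toℕ-punchIn-last j)) (sym (FinP.toℕ-fromℕ n)) (FinP.toℕ<n j)
    l-last<r : l θ last < r θ (punchIn last j)
    l-last<r = subst₂ _<_ (sym l-last≡p) (sym r≡1+p) (n<1+n p)

addLast-IsNCPPk⁻ : ∀ n k θ → IsNCPPk (suc n) (suc k) (addLast (suc (2 * n) ∸ k) θ) → IsNCPPk≥ n k θ
addLast-IsNCPPk⁻ n k θ ((pp , nc) , e) =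
  2 * n ∸ lastL θ , m+n≤o⇒m≤o∸n k (subst (_≤ 2 * n) (+-comm (lastL θ) k) lastL+k≤2n) , 2n∸lastL≤n pp′ ,
  (pp′ , insertPair-NonCrossing⁻ θ p (suc p) (fromℕ n) nc) , refl
  where
  p = suc (2 * n) ∸ k
  pp′ = addLast-IsPP⁻ pp
  p+1+k≡2+2n : p + suc k ≡ suc (suc (2 * n))
  p+1+k≡2+2n = trans (cong (_+ suc k) (sym (lastL-addLast p θ))) (trans (m∸n≡k⇒n+k≡m (lastL≤2n pp) e) (2*[1+n]≡2+2*n n))
  lastL+k≤2n : lastL θ + k ≤ 2 * n
  lastL+k≤2n = ≤-pred (≤-trans (+-monoˡ-≤ k (addLast⇒lastL< pp))
                               (≤-reflexive (suc-injective (trans (sym (+-suc p k)) p+1+k≡2+2n))))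

addLast-IsNCPPk : ∀ n k θ → IsNCPPk≥ n k θ → IsNCPPk (suc n) (suc k) (addLast (suc (2 * n) ∸ k) θ)
addLast-IsNCPPk n k θ (h , k≤h , h≤n , (pp , nc) , e) =
  (addLast-IsPP θ p pp 1≤p (m∸n≤m (suc (2 * n)) k) l<p , addLast-NonCrossing θ p nc) , 2+2n∸p≡1+k
  where
  p = suc (2 * n) ∸ k
  k≤2n : k ≤ 2 * n
  k≤2n = ≤-trans (≤-trans k≤h h≤n) (subst (n ≤_) (sym (2*n≡n+n n)) (m≤m+n n n))
  p≡1+[2n∸k] : p ≡ suc (2 * n ∸ k)
  p≡1+[2n∸k] = +-∸-assoc 1 k≤2n
  1≤p : 1 ≤ p
  1≤p = subst (1 ≤_) (sym p≡1+[2n∸k]) (s≤s z≤n)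
  lastL≤2n∸k : lastL θ ≤ 2 * n ∸ k
  lastL≤2n∸k = m+n≤o⇒m≤o∸n (lastL θ) (≤-trans (+-monoʳ-≤ (lastL θ) k≤h) (≤-reflexive (m∸n≡k⇒n+k≡m (lastL≤2n pp) e)))
  l<p : ∀ j → l θ j < p
  l<p j = subst (l θ j <_) (sym p≡1+[2n∸k]) (s≤s (≤-trans (l≤lastL pp j) lastL≤2n∸k))
  2+2n∸p≡1+k : 2 * suc n ∸ lastL (addLast p θ) ≡ suc k
  2+2n∸p≡1+k = trans (cong (2 * suc n ∸_) (lastL-addLast p θ))
    (n+k≡m⇒m∸n≡k (trans (+-suc p k) (trans (cong suc (m∸n+n≡m (≤-trans k≤2n (n≤1+n _)))) (sym (2*[1+n]≡2+2*n n)))))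

IsNCPPk⇔addLast : ∀ n k θ → IsNCPPk (suc n) (suc k) θ ⇔ Image (addLast (suc (2 * n) ∸ k)) (IsNCPPk≥ n k) θ
IsNCPPk⇔addLast n k θ = mk⇔
  (λ ncppk → let θ≡ = IsNCPPk⇒≡addLast n k θ ncppk in
             removeLast θ , addLast-IsNCPPk⁻ n k _ (subst (IsNCPPk (suc n) (suc k)) θ≡ ncppk) , θ≡)
  (λ { (θ′ , ncpp≥ , refl) → addLast-IsNCPPk n k θ′ ncpp≥ })

IsNCPPk-disjoint : ∀ {n} h h′ (θ : Fam n) → IsNCPPk n h θ → IsNCPPk n h′ θ → h ≡ h′
IsNCPPk-disjoint h h′ θ (_ , e) (_ , e′) = trans (sym e) e′

HasSize-IsNCPPk : ∀ n k → HasSize (IsNCPPk n k) (ncppCount n k)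
HasSize-IsNCPPk zero    zero    = HasSize-singleton [] λ { [] → mk⇔ (λ _ → refl) (λ _ → IsNCPP-[] , refl) }
HasSize-IsNCPPk zero    (suc k) = HasSize-∅ λ { [] (_ , ()) }
HasSize-IsNCPPk (suc n) zero    = HasSize-∅ λ θ ((pp , _) , e) →
  <-irrefl (trans (sym (+-identityʳ _)) (m∸n≡k⇒n+k≡m (lastL≤2n pp) e)) (lastL<2*[1+m] pp)
HasSize-IsNCPPk (suc n) (suc k) = HasSize-cong (⇔.sym ∘ IsNCPPk⇔addLast n k)
  (HasSize-image (addLast (suc (2 * n) ∸ k)) removeLast (removeLast-addLast _)
    (HasSize-⋃ (IsNCPPk n) (ncppCount n) (HasSize-IsNCPPk n) IsNCPPk-disjoint k n))

HasSize-IsNCPP : ∀ m → HasSize (IsNCPP m) (ncppCount (suc m) 1)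
HasSize-IsNCPP m = HasSize-cong some-k (HasSize-⋃ (IsNCPPk m) (ncppCount m) (HasSize-IsNCPPk m) IsNCPPk-disjoint 0 m)
  where
  some-k : ∀ θ → IsNCPPk≥ m 0 θ ⇔ IsNCPP m θ
  some-k θ = mk⇔ (λ (_ , _ , _ , ncpp , _) → ncpp) (λ ncpp → 2 * m ∸ lastL θ , z≤n , 2n∸lastL≤n (proj₁ ncpp) , ncpp , refl)

n+[1+[v∸[1+n]]]≡v : ∀ n v → suc n ≤ v → n + suc (v ∸ suc n) ≡ v
n+[1+[v∸[1+n]]]≡v n v 1+n≤v = trans (+-suc n (v ∸ suc n)) (m+[n∸m]≡n 1+n≤v)

v∸[1+n]<n : ∀ n v → suc n ≤ v → v ≤ 2 * n → v ∸ suc n < n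
v∸[1+n]<n n v 1+n≤v v≤2n = +-cancelˡ-≤ n (suc (v ∸ suc n)) n
  (subst (_≤ n + n) (sym (n+[1+[v∸[1+n]]]≡v n v 1+n≤v)) (subst (v ≤_) (2*n≡n+n n) v≤2n))

l-permFam : ∀ n σ h → l (permFam n σ) h ≡ suc (toℕ h)
l-permFam n σ h = cong proj₁ (VecP.lookup∘tabulate (λ h → suc (toℕ h) , n + suc (toℕ (σ ⟨$⟩ʳ h))) h)

r-permFam : ∀ n σ h → r (permFam n σ) h ≡ n + suc (toℕ (σ ⟨$⟩ʳ h))
r-permFam n σ h = cong proj₂ (VecP.lookup∘tabulate (λ h → suc (toℕ h) , n + suc (toℕ (σ ⟨$⟩ʳ h))) h)

permFam-IsPPk : ∀ m σ → IsPPk (suc m) (suc m) (permFam (suc m) σ)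
permFam-IsPPk m σ = record { l-range = l-range ; r-range = r-range ; cover = cover ; l<r = l<r ; l-incr = l-incr } ,
                    lastL≡n⇒2n∸lastL≡n {θ = θ} (trans (lastL≡l-last θ) (trans (l-permFam n σ (fromℕ m)) (cong suc (FinP.toℕ-fromℕ m))))
  where
  n = suc m
  θ = permFam n σ
  n≤2n : n ≤ 2 * n
  n≤2n = subst (n ≤_) (sym (2*n≡n+n n)) (m≤m+n n n)
  l-range : ∀ h → 1 ≤ l θ h × l θ h ≤ 2 * n
  l-range h = subst (λ x → 1 ≤ x × x ≤ 2 * n) (sym (l-permFam n σ h)) (s≤s z≤n , ≤-trans (FinP.toℕ<n h) n≤2n)
  r-range : ∀ h → 1 ≤ r θ h × r θ h ≤ 2 * n
  r-range h = subst (λ x → 1 ≤ x × x ≤ 2 * n) (sym (r-permFam n σ h))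
    (≤-trans (s≤s z≤n) (m≤n+m _ n) , subst (n + suc (toℕ (σ ⟨$⟩ʳ h)) ≤_) (sym (2*n≡n+n n)) (+-monoʳ-≤ n (FinP.toℕ<n (σ ⟨$⟩ʳ h))))
  cover : ∀ v → 1 ≤ v → v ≤ 2 * n → ∃ λ h → l θ h ≡ v ⊎ r θ h ≡ v
  cover (suc v) _ 1+v≤2n with suc v ≤? n
  ... | yes 1+v≤n = fromℕ< 1+v≤n , inj₁ (trans (l-permFam n σ _) (cong suc (FinP.toℕ-fromℕ< 1+v≤n)))
  ... | no  1+v≰n = σ ⟨$⟩ˡ j , inj₂ (begin
      r θ (σ ⟨$⟩ˡ j)                        ≡⟨ r-permFam n σ (σ ⟨$⟩ˡ j) ⟩
      n + suc (toℕ (σ ⟨$⟩ʳ (σ ⟨$⟩ˡ j)))    ≡⟨ cong (λ i → n + suc (toℕ i)) (inverseʳ σ) ⟩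
      n + suc (toℕ j)                       ≡⟨ cong (λ x → n + suc x) (FinP.toℕ-fromℕ< j<n) ⟩
      n + suc (suc v ∸ suc n)               ≡⟨ n+[1+[v∸[1+n]]]≡v n (suc v) (≰⇒> 1+v≰n) ⟩
      suc v                                 ∎)
    where
    j<n = v∸[1+n]<n n (suc v) (≰⇒> 1+v≰n) 1+v≤2n
    j = fromℕ< j<n
  l<r : ∀ h → l θ h < r θ h
  l<r h = subst₂ _<_ (sym (l-permFam n σ h)) (sym (r-permFam n σ h)) (≤-<-trans (FinP.toℕ<n h) (m<m+n n (s≤s z≤n)))
  l-incr : ∀ h k → h Fin.< k → l θ h < l θ k
  l-incr h k h<k = subst₂ _<_ (sym (l-permFam n σ h)) (sym (l-permFam n σ k)) (s≤s h<k)

-- The right endpoints of an element of PP_n(2n) are n+1, …, 2n in some order; that order is σ.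
IsPPk-n⇒permFam : ∀ m θ → IsPPk (suc m) (suc m) θ → ∃ λ (σ : Permutation′ (suc m)) → θ ≡ permFam (suc m) σ
IsPPk-n⇒permFam m θ (pp , e) = σ , lookup-extensional θ (permFam n σ) λ h → sym (begin
    lookup (permFam n σ) h                   ≡⟨ VecP.lookup∘tabulate (λ h → suc (toℕ h) , n + suc (toℕ (σ ⟨$⟩ʳ h))) h ⟩
    suc (toℕ h) , n + suc (toℕ (σʳ h))       ≡⟨ cong₂ _,_ (sym (l≡1+index pp lastL≡n h)) (n+1+σʳ≡r h) ⟩
    l θ h , r θ h                            ∎)
  where
  open IsPP pp
  n = suc m
  lastL≡n = 2n∸lastL≡n⇒lastL≡n pp e
  n<r = 1+m<r pp lastL≡n
  σʳ : Fin n → Fin n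
  σʳ h = fromℕ< (v∸[1+n]<n n (r θ h) (n<r h) (proj₂ (r-range h)))
  n+1+σʳ≡r : ∀ h → n + suc (toℕ (σʳ h)) ≡ r θ h
  n+1+σʳ≡r h = trans (cong (λ x → n + suc x) (FinP.toℕ-fromℕ< _)) (n+[1+[v∸[1+n]]]≡v n (r θ h) (n<r h))
  partner : (j : Fin n) → Σ (Fin n) λ h → r θ h ≡ n + suc (toℕ j)
  partner j with cover (n + suc (toℕ j)) (≤-trans (s≤s z≤n) (m≤n+m _ n))
                       (subst (n + suc (toℕ j) ≤_) (sym (2*n≡n+n n)) (+-monoʳ-≤ n (FinP.toℕ<n j)))
  ... | h , inj₂ r≡ = h , r≡
  ... | h , inj₁ l≡ = ⊥-elim (<-irrefl refl (≤-<-trans (subst (_≤ n) (sym (l≡1+index pp lastL≡n h)) (FinP.toℕ<n h))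
                                               (subst (n <_) (sym l≡) (m<m+n n (s≤s z≤n)))))
  σˡ : Fin n → Fin n
  σˡ = proj₁ ∘ partner
  σ : Permutation′ n
  σ = permutation σʳ σˡ
    (λ j → FinP.toℕ-injective (+-cancelˡ-≡ n _ _ (suc-injective′ (trans (n+1+σʳ≡r (σˡ j)) (proj₂ (partner j))))))
    (λ h → Endpoints.r-injective pp (σˡ (σʳ h)) h (trans (proj₂ (partner (σʳ h))) (n+1+σʳ≡r h)))
    where
    suc-injective′ : ∀ {a b} → n + suc a ≡ n + suc b → n + a ≡ n + b
    suc-injective′ {a} {b} e = suc-injective (trans (sym (+-suc n a)) (trans e (+-suc n b)))

IsPPk-n⇔permFam : ∀ m θ → IsPPk (suc m) (suc m) θ ⇔ (∃ λ (σ : Permutation′ (suc m)) → θ ≡ permFam (suc m) σ)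
IsPPk-n⇔permFam m θ = mk⇔ (IsPPk-n⇒permFam m θ) λ { (σ , refl) → permFam-IsPPk m σ }

lookup-nested : ∀ n h → lookup (nested n) h ≡ (suc (toℕ h) , 2 * n + 1 ∸ suc (toℕ h))
lookup-nested n = VecP.lookup∘tabulate (λ h → suc (toℕ h) , 2 * n + 1 ∸ suc (toℕ h))

l-nested : ∀ n h → l (nested n) h ≡ suc (toℕ h)
l-nested n h = cong proj₁ (lookup-nested n h)

r-nested : ∀ n h → r (nested n) h ≡ 2 * n ∸ toℕ h
r-nested n h = trans (cong proj₂ (lookup-nested n h)) (cong (_∸ suc (toℕ h)) (+-comm (2 * n) 1))

nested≡permFam-reverse : ∀ n → nested n ≡ permFam n reverse
nested≡permFam-reverse n = lookup-extensional (nested n) (permFam n reverse) λ h → begin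
  lookup (nested n) h                       ≡⟨ cong₂ _,_ (l-nested n h) (r-nested n h) ⟩
  suc (toℕ h) , 2 * n ∸ toℕ h               ≡⟨ cong (suc (toℕ h) ,_) (2n∸t≡n+[1+opposite] h) ⟩
  suc (toℕ h) , n + suc (toℕ (Fin.opposite h)) ≡⟨ sym (VecP.lookup∘tabulate (λ h → suc (toℕ h) , n + suc (toℕ (reverse ⟨$⟩ʳ h))) h) ⟩
  lookup (permFam n reverse) h              ∎
  where
  2n∸t≡n+[1+opposite] : ∀ h → 2 * n ∸ toℕ h ≡ n + suc (toℕ (Fin.opposite h))
  2n∸t≡n+[1+opposite] h = begin
    2 * n ∸ toℕ h               ≡⟨ cong (_∸ toℕ h) (2*n≡n+n n) ⟩
    n + n ∸ toℕ h               ≡⟨ +-∸-assoc n (<⇒≤ (FinP.toℕ<n h)) ⟩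
    n + (n ∸ toℕ h)             ≡⟨ cong (n +_) (+-∸-assoc 1 (FinP.toℕ<n h)) ⟩
    n + suc (n ∸ suc (toℕ h))   ≡⟨ cong (λ x → n + suc x) (sym (FinP.opposite-prop h)) ⟩
    n + suc (toℕ (Fin.opposite h)) ∎

nested-IsNCPPk : ∀ m → IsNCPPk (suc m) (suc m) (nested (suc m))
nested-IsNCPPk m = (pp , nc) , e
  where
  n = suc m
  pp,e = subst (IsPPk n n) (sym (nested≡permFam-reverse n)) (permFam-IsPPk m reverse)
  pp = proj₁ pp,e
  e = proj₂ pp,e
  nc : NonCrossing (nested n)
  nc h k h<k = mk⇔ (λ _ → r-k<r-h) (λ _ → l-k<r-h)
    where
    lastL≡n = 2n∸lastL≡n⇒lastL≡n pp e
    r-k<r-h : r (nested n) k < r (nested n) h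
    r-k<r-h = subst₂ _<_ (sym (r-nested n k)) (sym (r-nested n h))
                     (∸-monoʳ-< h<k (≤-trans (<⇒≤ (FinP.toℕ<n k)) (m≤m+n n (n + 0))))
    l-k<r-h : l (nested n) k < r (nested n) h
    l-k<r-h = subst (_< r (nested n) h) (sym (l≡1+index pp lastL≡n k)) (≤-<-trans (FinP.toℕ<n k) (1+m<r pp lastL≡n h))

-- Non-crossing forces the right endpoints, all above n, to decrease; being n distinct values
-- in {n+1, …, 2n}, they are 2n, 2n−1, …, n+1.
IsNCPPk-n⇒nested : ∀ m θ → IsNCPPk (suc m) (suc m) θ → θ ≡ nested (suc m)
IsNCPPk-n⇒nested m θ ((pp , nc) , e) = lookup-extensional θ (nested n) λ h →
  cong₂ _,_ (trans (l≡1+index pp lastL≡n h) (sym (l-nested n h)))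
            (trans (r≡2n∸index h) (sym (r-nested n h)))
  where
  n = suc m
  lastL≡n = 2n∸lastL≡n⇒lastL≡n pp e
  r-decreasing : ∀ h k → toℕ h < toℕ k → r θ k < r θ h
  r-decreasing h k h<k = to (nc h k h<k)
    (subst (_< r θ h) (sym (l≡1+index pp lastL≡n k)) (≤-<-trans (FinP.toℕ<n k) (1+m<r pp lastL≡n h)))
  r≡2n∸index : ∀ h → r θ h ≡ 2 * n ∸ toℕ h
  r≡2n∸index h = ≤-antisym upper lower
    where
    t = toℕ h
    t≤m : t ≤ m
    t≤m = ≤-pred (FinP.toℕ<n h)
    upper : r θ h ≤ 2 * n ∸ t
    upper = m+n≤o⇒m≤o∸n (r θ h) (≤-trans (decreasing⇒spread (r θ) r-decreasing t zero h refl) (proj₂ (IsPP.r-range pp zero)))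
    lower : 2 * n ∸ t ≤ r θ h
    lower = subst (_≤ r θ h) (sym (trans (cong (_∸ t) (2*[1+m]≡2+m+m m)) (+-∸-assoc (suc (suc m)) t≤m)))
      (≤-trans (+-monoˡ-≤ (m ∸ t) (1+m<r pp lastL≡n (fromℕ m)))
               (decreasing⇒spread (r θ) r-decreasing (m ∸ t) h (fromℕ m) (trans (FinP.toℕ-fromℕ m) (sym (m+[n∸m]≡n t≤m)))))
      where
      2*[1+m]≡2+m+m : ∀ m → 2 * suc m ≡ suc (suc m) + m
      2*[1+m]≡2+m+m = solve-∀

IsNCPPk-n⇔nested : ∀ m θ → IsNCPPk (suc m) (suc m) θ ⇔ θ ≡ nested (suc m)
IsNCPPk-n⇔nested m θ = mk⇔ (IsNCPPk-n⇒nested m θ) λ { refl → nested-IsNCPPk m }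

IsNCPPk-suc↔IsNCPPk≥ : ∀ n k → Bij (IsNCPPk (suc n) (suc k)) (IsNCPPk≥ n k)
IsNCPPk-suc↔IsNCPPk≥ n k = image⇒Bij removeLast (addLast _) (removeLast-addLast _) (IsNCPPk⇔addLast n k)

IsNCPPk≥1⇔IsNCPP : ∀ m θ → IsNCPPk≥ (suc m) 1 θ ⇔ IsNCPP (suc m) θ
IsNCPPk≥1⇔IsNCPP m θ = mk⇔ (λ (_ , _ , _ , ncpp , _) → ncpp)
  (λ ncpp → 2 * suc m ∸ lastL θ , m<n⇒0<n∸m (lastL<2*[1+m] (proj₁ ncpp)) , 2n∸lastL≤n (proj₁ ncpp) , ncpp , refl)

IsNCPPk-2↔IsNCPP : ∀ m → Bij (IsNCPPk (suc (suc m)) 2) (IsNCPP (suc m))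
IsNCPPk-2↔IsNCPP m = image⇒Bij removeLast (addLast _) (removeLast-addLast _) λ θ →
  ⇔.trans (IsNCPPk⇔addLast (suc m) 1 θ)
    (mk⇔ (λ (θ′ , ncpp≥ , θ≡) → θ′ , to (IsNCPPk≥1⇔IsNCPP m θ′) ncpp≥ , θ≡)
         (λ (θ′ , ncpp , θ≡) → θ′ , from (IsNCPPk≥1⇔IsNCPP m θ′) ncpp , θ≡))

catalan≡[2n∸2]C[n∸1]/n : ∀ m → catalan m ≡ ((2 * suc m ∸ 2) C m) / suc m
catalan≡[2n∸2]C[n∸1]/n m = cong (λ x → ((x ∸ 2) C m) / suc m) (sym (2*[1+n]≡2+2*n m))

proposition2p7-3 : ∀ m → 2 < suc m →
    (∀ k → 2 ≤ k → k ≤ suc m ∸ 1 →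
       Bij (IsNCPPk (suc m) k)
           (λ θ → ∃ λ h → k ∸ 1 ≤ h × h ≤ suc m ∸ 1 × IsNCPPk (suc m ∸ 1) h θ)
       × Σ (ℕ → ℕ) λ b →
           (∀ h → k ∸ 1 ≤ h → h ≤ suc m ∸ 1 → HasSize (IsNCPPk (suc m ∸ 1) h) (b h))
           × HasSize (IsNCPPk (suc m) k) (sumFromTo (k ∸ 1) (suc m ∸ 1) b))
    × Bij (IsNCPPk (suc m) 2) (IsNCPP (suc m ∸ 1))
    × HasSize (IsNCPPk (suc m) 2) (catalan (suc m ∸ 1))
    × HasSize (IsNCPPk (suc m) 1) (catalan (suc m ∸ 1))
    × HasSize (IsNCPP (suc m ∸ 1)) (catalan (suc m ∸ 1))
    × catalan (suc m ∸ 1) ≡ ((2 * suc m ∸ 2) C (suc m ∸ 1)) / suc m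
    × HasSize (IsNCPPk (suc m) (suc m ∸ 1)) (suc m ∸ 1)
proposition2p7-3 (suc (suc m)) _ =
    (λ { (suc k) _ _ → IsNCPPk-suc↔IsNCPPk≥ n k , ncppCount n , (λ h _ _ → HasSize-IsNCPPk n h) , HasSize-IsNCPPk (suc n) (suc k) })
  , IsNCPPk-2↔IsNCPP (suc m)
  , subst (HasSize (IsNCPPk (suc n) 2)) (trans (ncppCount-2≡1 (suc m)) (ncppCount-catalan n)) (HasSize-IsNCPPk (suc n) 2)
  , subst (HasSize (IsNCPPk (suc n) 1)) (ncppCount-catalan n) (HasSize-IsNCPPk (suc n) 1)
  , subst (HasSize (IsNCPP n)) (ncppCount-catalan n) (HasSize-IsNCPP n)
  , catalan≡[2n∸2]C[n∸1]/n n
  , subst (HasSize (IsNCPPk (suc n) n)) (ncppCount-subdiag n) (HasSize-IsNCPPk (suc n) n)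
  where n = suc (suc m)
proposition2p7-3 zero          (s≤s ())
proposition2p7-3 (suc zero)    (s≤s (s≤s ()))

proposition2p7 : (n : ℕ) → {{_ : NonZero n}} →
    ((∀ θ → (IsNCPPk n n θ ⇔ θ ≡ nested n))
     × (∀ θ → (IsPPk n n θ ⇔ ∃ λ (σ : Permutation′ n) → θ ≡ permFam n σ))
     × HasSize (IsPPk n n) (n !)
     × HasSize (IsNCPPk n n) 1)
    × (HasSize (IsPPk n 1) (oddFact (n ∸ 1))
     × HasSize (IsPP (n ∸ 1)) (oddFact (n ∸ 1))
     × HasSize (IsNCPPk n 1) (((2 * n ∸ 2) C (n ∸ 1)) / n)
     × HasSize (IsNCPP (n ∸ 1)) (((2 * n ∸ 2) C (n ∸ 1)) / n))
    × (2 < n →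
       (∀ k → 2 ≤ k → k ≤ n ∸ 1 →
          Bij (IsNCPPk n k)
              (λ θ → ∃ λ h → k ∸ 1 ≤ h × h ≤ n ∸ 1 × IsNCPPk (n ∸ 1) h θ)
          × Σ (ℕ → ℕ) λ b →
              (∀ h → k ∸ 1 ≤ h → h ≤ n ∸ 1 → HasSize (IsNCPPk (n ∸ 1) h) (b h))
              × HasSize (IsNCPPk n k) (sumFromTo (k ∸ 1) (n ∸ 1) b))
       × Bij (IsNCPPk n 2) (IsNCPP (n ∸ 1))
       × HasSize (IsNCPPk n 2) (catalan (n ∸ 1))
       × HasSize (IsNCPPk n 1) (catalan (n ∸ 1))
       × HasSize (IsNCPP (n ∸ 1)) (catalan (n ∸ 1))
       × catalan (n ∸ 1) ≡ ((2 * n ∸ 2) C (n ∸ 1)) / n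
       × HasSize (IsNCPPk n (n ∸ 1)) (n ∸ 1))
proposition2p7 (suc m) =
    ( IsNCPPk-n⇔nested m
    , IsPPk-n⇔permFam m
    , HasSize-IsPPk-n (suc m)
    , HasSize-singleton (nested (suc m)) (IsNCPPk-n⇔nested m))
  , ( HasSize-IsPPk-1 m
    , HasSize-IsPP m
    , subst (HasSize (IsNCPPk (suc m) 1)) ncppCount≡ (HasSize-IsNCPPk (suc m) 1)
    , subst (HasSize (IsNCPP m)) ncppCount≡ (HasSize-IsNCPP m))
  , proposition2p7-3 m
  where
  ncppCount≡ : ncppCount (suc m) 1 ≡ ((2 * suc m ∸ 2) C m) / suc m
  ncppCount≡ = trans (ncppCount-catalan m) (catalan≡[2n∸2]C[n∸1]/n m)
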